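{- Let $L$ be the line through $\mathrm{P}(1,0,0,1)$ and $\mathrm{P}(0,0,1,0)$ and $G_q^{L}$ the subgroup of $G_q$ fixing $L$. (i) If $q$ is odd and $q\equiv-1\pmod3$, then $|G_q^{L}|=2$ and the non-trivial element of $G_q^{L}$ is induced by the matrix $M$ below with $a=\sqrt[3]{1/2}$, $b=1$, $c=\sqrt[3]{2}$, $d=-\sqrt[3]{1/2}$ (cube roots are unique in this case). (ii) If $q$ is odd, $q\equiv1\pmod3$, and $-1/2$ is a cube in $\mathbb{F}_q$, then $|G_q^{L}|=12$, $G_q^{L}\cong A_4$, and every element of $G_q^{L}$ is induced either by a matrix $\mathrm{diag}(1,d,d^2,d^3)$ with $d^3=1$, or by the matrix $M$ below with $a$ a cube root of $1/2$, $b=1$, $d$ a cube root of $-1/2$, and $c=-d/a^2$.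
   Context: $\mathrm{P}(x_0,x_1,x_2,x_3)$ denotes a point of $\mathrm{PG}(3,q)$ in homogeneous coordinates; a matrix $M$ induces the projectivity $\mathrm{P}(x)\mapsto\mathrm{P}(xM)$ ($x$ a row vector). The twisted cubic is $\mathcal{C}=\{P(t): t\in\mathbb{F}_q\cup\{\infty\}\}$, $P(t)=\mathrm{P}(t^3,t^2,t,1)$ for $t\in\mathbb{F}_q$, $P(\infty)=\mathrm{P}(1,0,0,0)$. $G_q$ is the group of projectivities mapping $\mathcal{C}$ onto itself; for $q\ge 5$ its elements are exactly those induced by $M=\begin{pmatrix} a^3&a^2c&ac^2&c^3\\ 3a^2b&a^2d+2abc&bc^2+2acd&3c^2d\\ 3ab^2&b^2c+2abd&ad^2+2bcd&3cd^2\\ b^3&b^2d&bd^2&d^3\end{pmatrix}$, $a,b,c,d\in\mathbb{F}_q$, $ad-bc\ne0$ (up to nonzero scalar). -}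

module Defs where

open import Data.Nat as ℕ using (ℕ; _%_)
open import Data.Fin as Fin using (Fin; zero; suc; toℕ; _<?_)
open import Data.Fin.Permutation as Perm using (Permutation′; _⟨$⟩ʳ_; _∘ₚ_)
open import Data.List using (List; length; filter; cartesianProduct; allFin)
open import Data.Product using (Σ; _×_; _,_; proj₁; proj₂)
open import Data.Sum using (_⊎_)
open import Relation.Nullary using (¬_)
open import Relation.Nullary.Decidable using (_×-dec_)
open import Relation.Binary.PropositionalEquality using (_≡_; _≢_)
open import Algebra.Structures using (IsCommutativeRing)
open import Function.Bundles using (_↔_)

record FiniteField (q : ℕ) : Set₁ where
  infixl 6 _+_
  infixl 7 _*_
  infix  8 -_
  field
    F    : Set
    _+_  : F → F → F
    _*_  : F → F → F
    -_   : F → F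
    0#   : F
    1#   : F
    isCommutativeRing : IsCommutativeRing _≡_ _+_ _*_ -_ 0# 1#
    1≢0     : 1# ≢ 0#
    inverse : ∀ x → x ≢ 0# → Σ F (λ y → x * y ≡ 1#)
    card    : F ↔ Fin q

-- The alternating group A₄: even permutations of Fin 4
-- (parity via the number of inversions).

Perm4 : Set
Perm4 = Permutation′ 4

inversions : Perm4 → ℕ
inversions σ =
  length (filter (λ p → (proj₁ p <? proj₂ p) ×-dec ((σ ⟨$⟩ʳ proj₂ p) <? (σ ⟨$⟩ʳ proj₁ p)))
                 (cartesianProduct (allFin 4) (allFin 4)))

Even : Perm4 → Set
Even σ = inversions σ % 2 ≡ 0

module Geometry {q : ℕ} (𝔽 : FiniteField q) where
  open FiniteField 𝔽 public

  2# 3# : F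
  2# = 1# + 1#
  3# = 2# + 1#

  cube : F → F
  cube x = x * x * x

  Vec4 : Set
  Vec4 = Fin 4 → F

  Mat4 : Set
  Mat4 = Fin 4 → Fin 4 → F

  sum4 : (Fin 4 → F) → F
  sum4 f = f zero + f (suc zero) + f (suc (suc zero)) + f (suc (suc (suc zero)))

  _⋆_ : Vec4 → Mat4 → Vec4
  (x ⋆ M) j = sum4 (λ i → x i * M i j)

  -- matrix product; the projectivity of M followed by that of N is induced by M ·ₘ N
  _·ₘ_ : Mat4 → Mat4 → Mat4
  (M ·ₘ N) i k = sum4 (λ j → M i j * N j k)

  vec : F → F → F → F → Vec4
  vec x0 x1 x2 x3 zero = x0
  vec x0 x1 x2 x3 (suc zero) = x1
  vec x0 x1 x2 x3 (suc (suc zero)) = x2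
  vec x0 x1 x2 x3 (suc (suc (suc zero))) = x3

  rows : Vec4 → Vec4 → Vec4 → Vec4 → Mat4
  rows r0 r1 r2 r3 zero = r0
  rows r0 r1 r2 r3 (suc zero) = r1
  rows r0 r1 r2 r3 (suc (suc zero)) = r2
  rows r0 r1 r2 r3 (suc (suc (suc zero))) = r3

  -- two matrices induce the same projectivity iff they are proportional
  _∼_ : Mat4 → Mat4 → Set
  M ∼ N = Σ F (λ λ' → λ' ≢ 0# × (∀ i j → N i j ≡ λ' * M i j))

  Mt : F → F → F → F → Mat4
  Mt a b c d = rows
    (vec (a * a * a)        (a * a * c)                  (a * c * c)                  (c * c * c))
    (vec (3# * a * a * b)   (a * a * d + 2# * a * b * c) (b * c * c + 2# * a * c * d) (3# * c * c * d))
    (vec (3# * a * b * b)   (b * b * c + 2# * a * b * d) (a * d * d + 2# * b * c * d) (3# * c * d * d))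
    (vec (b * b * b)        (b * b * d)                  (b * d * d)                  (d * d * d))

  InG : Mat4 → Set
  InG M = Σ F λ a → Σ F λ b → Σ F λ c → Σ F λ d →
            (a * d + - (b * c) ≢ 0#) × (M ∼ Mt a b c d)

  OnL : Vec4 → Set
  OnL x = Σ F λ λ' → Σ F λ μ → ∀ i → x i ≡ λ' * vec 1# 0# 0# 1# i + μ * vec 0# 0# 1# 0# i

  FixesL : Mat4 → Set
  FixesL M = (∀ x → OnL x → OnL (x ⋆ M))
           × (∀ y → OnL y → Σ Vec4 λ x → OnL x × (∀ i → (x ⋆ M) i ≡ y i))

  InGL : Mat4 → Set
  InGL M = InG M × FixesL M

  -- f lists the elements of G_q^L exactly once each (up to ∼): |G_q^L| = n
  Enumerates : {n : ℕ} → (Fin n → Mat4) → Set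
  Enumerates {n} f = (∀ i → InGL (f i))
                   × (∀ i j → f i ∼ f j → i ≡ j)
                   × (∀ M → InGL M → Σ (Fin n) λ i → M ∼ f i)

  HasOrder : ℕ → Set
  HasOrder n = Σ (Fin n → Mat4) Enumerates

  pair : Mat4 → Mat4 → Fin 2 → Mat4
  pair A B zero = A
  pair A B (suc _) = B

  Id : Mat4
  Id = rows (vec 1# 0# 0# 0#) (vec 0# 1# 0# 0#) (vec 0# 0# 1# 0#) (vec 0# 0# 0# 1#)

  Diag : F → Mat4
  Diag d = rows (vec 1# 0# 0# 0#) (vec 0# d 0# 0#) (vec 0# 0# (d * d) 0#) (vec 0# 0# 0# (d * d * d))

  IsoA4 : Set
  IsoA4 = Σ ((M : Mat4) → InGL M → Perm4) λ φ →
      (∀ M p → Even (φ M p))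
    × (∀ M N p p' → M ∼ N → φ M p Perm.≈ φ N p')
    × (∀ M N p p' → φ M p Perm.≈ φ N p' → M ∼ N)
    × (∀ σ → Even σ → Σ Mat4 λ M → Σ (InGL M) λ p → φ M p Perm.≈ σ)
    × (∀ M N p p' p'' → φ (M ·ₘ N) p'' Perm.≈ (φ M p ∘ₚ φ N p'))

{-# OPTIONS --safe #-}
module Submission where

-- Every element of G_q is induced by some M(a,b,c,d), which acts on the cubic as the Möbius map
-- (u : v) ↦ (au + bv : cu + dv).  It fixes L iff it maps P(1,0,0,1) and P(0,0,1,0) into L with
-- independent images.  As q is odd and prime to 3, 2 and 3 are invertible, and in coordinates this
-- leaves b = c = 0 with (d/a)³ = 1, i.e. diag(1,e,e²,e³) with e³ = 1, or, scaled to b = 1,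
-- 2a³ = 1, 2d³ = −1 and c = −2ad.  If q ≡ 2 (mod 3), cubing is a bijection of F_q (Fermat), so only
-- the identity and one more element survive.  If q ≡ 1 (mod 3) there is a primitive cube root of
-- unity ω and there are 3 + 3·3 elements; with 2t³ = −1 they permute the four points P(∞), P(t²ωᵏ)
-- of the cubic faithfully and evenly, and every even permutation occurs, whence G_q^L ≅ A₄.

open import Defs
open import Data.Nat as ℕ using (ℕ; zero; suc; _%_)
open import Data.Product using (Σ; _×_)
open import Data.Sum using (_⊎_)
open import Relation.Binary.PropositionalEquality using (_≡_)
import Data.Nat.Properties as ℕ
open import Data.Nat.DivMod using (_/_; m≡m%n+[m/n]*n)
open import Data.Integer as ℤ using (ℤ; -[1+_])
import Data.Integer.Properties as ℤ
open import Data.Sign as Sign using (Sign)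
open import Data.Maybe using (Maybe; just; nothing)
open import Data.Empty using (⊥-elim)
open import Data.Sum using (inj₁; inj₂; [_,_]′)
open import Data.Sum.Function.Propositional using (_⊎-↔_)
open import Data.Product using (∃; _,_; proj₁; proj₂)
open import Data.Fin as Fin using (Fin; zero; suc; punchIn; _<?_)
open import Data.Fin.Patterns using (0F; 1F; 2F; 3F)
import Data.Fin.Properties as Fin
open import Data.Fin.Properties using (all?; any?; +↔⊎; *↔×) renaming (_≟_ to _≟ᶠ_)
open import Data.Fin.Permutation as Perm using (Permutation′; permutation; _⟨$⟩ʳ_; _⟨$⟩ˡ_; _∘ₚ_)
open import Data.List using (length; filter; cartesianProduct; allFin)
open import Data.List.Properties using (filter-≐)
open import Data.Vec using (Vec; []; _∷_; replicate)
open import Function using (_↔_; Inverse; _∘_)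
open import Function.Construct.Composition using (_↔-∘_)
open import Function.Construct.Identity using (↔-id)
open import Relation.Binary.PropositionalEquality
open import Relation.Nullary using (Dec; yes; no)
open import Relation.Nullary.Decidable using (map′; ¬?; decidable-stable; toWitness; _×-dec_; _→-dec_)
open import Algebra.Bundles using (CommutativeRing)
import Algebra.Solver.Ring.AlmostCommutativeRing as ACR
import Algebra.Properties.CommutativeMonoid.Sum as Sum

-- Even permutations of four points

infixl 6 _⊕_
_⊕_ : Fin 3 → Fin 3 → Fin 3
0F ⊕ j  = j
1F ⊕ 0F = 1F
1F ⊕ 1F = 2F
1F ⊕ 2F = 0F
2F ⊕ 0F = 2F
2F ⊕ 1F = 0F
2F ⊕ 2F = 1F

-- diag m and mt i j stand for the elements Diag ωᵐ and M(−tωⁱ, 1, 2t²ωⁱ⁺ʲ, tωʲ) of G_q^L, and act K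
-- for the permutation they induce on the points P(∞) (index 0F) and P(t²ωᵏ) (index suc k).
Kind : Set
Kind = Fin 3 ⊎ Fin 3 × Fin 3

pattern diag m = inj₁ m
pattern mt i j = inj₂ (i , j)

mt-image : Fin 3 → Fin 3 → Fin 4
mt-image j 0F          = 0F
mt-image j l@(suc _)   = suc ((j ⊕ l) ⊕ (j ⊕ l))

act : Kind → Fin 4 → Fin 4
act (diag m) 0F      = 0F
act (diag m) (suc k) = suc (k ⊕ (m ⊕ m))
act (mt i j) 0F      = suc (j ⊕ j)
act (mt i j) (suc k) = mt-image j (i ⊕ k)

kinds : Fin 12 ↔ Kind
kinds = (↔-id (Fin 3) ⊎-↔ *↔×) ↔-∘ +↔⊎

kind : Fin 12 → Kind
kind = Inverse.to kinds

every-kind : ∀ {p} {P : Kind → Set p} → (∀ i → P (kind i)) → ∀ K → P K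
every-kind {P = P} h K = subst P (Inverse.strictlyInverseˡ kinds K) (h (Inverse.from kinds K))

preimage : (Fin 4 → Fin 4) → Fin 4 → Fin 4
preimage f y with any? (λ x → f x ≟ᶠ y)
... | yes (x , _) = x
... | no _        = y   -- never reached for the bijections act K

act-preimage : ∀ K y → act K (preimage (act K) y) ≡ y
act-preimage = every-kind (toWitness {a? = all? λ i → all? λ y →
  act (kind i) (preimage (act (kind i)) y) ≟ᶠ y} _)

preimage-act : ∀ K x → preimage (act K) (act K x) ≡ x
preimage-act = every-kind (toWitness {a? = all? λ i → all? λ x →
  preimage (act (kind i)) (act (kind i) x) ≟ᶠ x} _)

perm : Kind → Perm4
perm K = permutation (act K) (preimage (act K)) (act-preimage K) (preimage-act K)

perm-even : ∀ K → Even (perm K)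
perm-even = every-kind (toWitness {a? = all? λ i → inversions (perm (kind i)) % 2 ℕ.≟ 0} _)

act-injective : ∀ K K′ → (∀ x → act K x ≡ act K′ x) → K ≡ K′
act-injective = every-kind λ i → every-kind λ j same → cong kind (by-indices i j same)
  where
  by-indices : ∀ i j → (∀ x → act (kind i) x ≡ act (kind j) x) → i ≡ j
  by-indices = toWitness {a? = all? λ i → all? λ j →
    (all? λ x → act (kind i) x ≟ᶠ act (kind j) x) →-dec (i ≟ᶠ j)} _

Inversion : (Fin 4 → Fin 4) → Fin 4 × Fin 4 → Set
Inversion f (i , j) = i Fin.< j × f j Fin.< f i

inversion? : ∀ f p → Dec (Inversion f p)
inversion? f (i , j) = (i <? j) ×-dec (f j <? f i)

inversionsOf : (Fin 4 → Fin 4) → ℕ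
inversionsOf f = length (filter (inversion? f) (cartesianProduct (allFin 4) (allFin 4)))

tuple : Fin 4 → Fin 4 → Fin 4 → Fin 4 → Fin 4 → Fin 4
tuple a b c d 0F = a
tuple a b c d 1F = b
tuple a b c d 2F = c
tuple a b c d 3F = d

inversionsOf-cong : ∀ {f g} → (∀ x → f x ≡ g x) → inversionsOf f ≡ inversionsOf g
inversionsOf-cong f≗g = cong length
  (filter-≐ (inversion? _) (inversion? _) (transport f≗g , transport (sym ∘ f≗g)) (cartesianProduct (allFin 4) (allFin 4)))
  where
  transport : ∀ {f g} → (∀ x → f x ≡ g x) → ∀ {p} → Inversion f p → Inversion g p
  transport f≗g {i , j} (i<j , fj<fi) = i<j , subst₂ Fin._<_ (f≗g j) (f≗g i) fj<fi

-- Opaque: unfolding this 4⁴-case check where it is used exhausts memory.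
opaque
  even-tuple-is-act : ∀ a b c d → (∀ x y → tuple a b c d x ≡ tuple a b c d y → x ≡ y) →
    inversionsOf (tuple a b c d) % 2 ≡ 0 → ∃ λ i → ∀ x → act (kind i) x ≡ tuple a b c d x
  even-tuple-is-act = toWitness {a? = all? λ a → all? λ b → all? λ c → all? λ d →
    (all? λ x → all? λ y → (tuple a b c d x ≟ᶠ tuple a b c d y) →-dec (x ≟ᶠ y)) →-dec
    (inversionsOf (tuple a b c d) % 2 ℕ.≟ 0 →-dec
    any? λ i → all? λ x → act (kind i) x ≟ᶠ tuple a b c d x)} _

-- inversions σ unfolds to inversionsOf (σ ⟨$⟩ʳ_).
even⇒perm : ∀ σ → Even σ → Σ Kind λ K → perm K Perm.≈ σ
even⇒perm σ even = kind (proj₁ found) , λ x → trans (proj₂ found x) (sym (σ≗tuple x))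
  where
  σ≗tuple : ∀ x → σ ⟨$⟩ʳ x ≡ tuple (σ ⟨$⟩ʳ 0F) (σ ⟨$⟩ʳ 1F) (σ ⟨$⟩ʳ 2F) (σ ⟨$⟩ʳ 3F) x
  σ≗tuple 0F = refl
  σ≗tuple 1F = refl
  σ≗tuple 2F = refl
  σ≗tuple 3F = refl
  σ-injective : ∀ x y → σ ⟨$⟩ʳ x ≡ σ ⟨$⟩ʳ y → x ≡ y
  σ-injective x y e = trans (sym (Perm.inverseˡ σ)) (trans (cong (σ ⟨$⟩ˡ_) e) (Perm.inverseˡ σ))
  found : ∃ λ i → ∀ x → act (kind i) x ≡ tuple (σ ⟨$⟩ʳ 0F) (σ ⟨$⟩ʳ 1F) (σ ⟨$⟩ʳ 2F) (σ ⟨$⟩ʳ 3F) x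
  found = even-tuple-is-act (σ ⟨$⟩ʳ 0F) (σ ⟨$⟩ʳ 1F) (σ ⟨$⟩ʳ 2F) (σ ⟨$⟩ʳ 3F)
    (λ x y e → σ-injective x y (trans (σ≗tuple x) (trans e (sym (σ≗tuple y)))))
    (trans (cong (_% 2) (inversionsOf-cong (λ x → sym (σ≗tuple x)))) even)

module _ {q : ℕ} (𝔽 : FiniteField q) where
  open Geometry 𝔽

  ring : CommutativeRing _ _
  ring = record { isCommutativeRing = isCommutativeRing }

  open CommutativeRing ring
    using ( +-comm; +-identityˡ; +-identityʳ; -‿inverseʳ; *-assoc; *-comm
          ; *-identityˡ; *-identityʳ; zeroˡ; zeroʳ; distribˡ
          ; +-commutativeMonoid; *-commutativeMonoid; +-group)
  open import Algebra.Properties.Ring (CommutativeRing.ring ring)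
    using (-‿distribˡ-*; -‿involutive; -‿+-comm; -0#≈0#)
  open import Algebra.Properties.CommutativeSemigroup (CommutativeRing.*-commutativeSemigroup ring)
    using () renaming (interchange to *-interchange)
  open import Algebra.Properties.CommutativeSemigroup (CommutativeRing.+-commutativeSemigroup ring)
    using () renaming (interchange to +-interchange; x∙yz≈y∙xz to x+[y+z]≡y+[x+z])
  open import Algebra.Properties.Semiring.Mult.TCOptimised (CommutativeRing.semiring ring)
    using (×-homo-+; ×1-homo-*; 1+×; ×ᵤ≈×) renaming (_×_ to _×′_)

  -- Ring identities are proved by Algebra.Solver.Ring with integer coefficients, read in F through
  -- fromℤ; the numerals 2#, 3# of F are then definitionally fromℤ 2, fromℤ 3.
  sign : Sign → F
  sign Sign.+ = 1#
  sign Sign.- = - 1#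

  sign-* : ∀ s t → sign (s Sign.* t) ≡ sign s * sign t
  sign-* Sign.+ t      = sym (*-identityˡ _)
  sign-* Sign.- Sign.+ = sym (*-identityʳ _)
  sign-* Sign.- Sign.- = sym (trans (sym (-‿distribˡ-* _ _)) (trans (cong -_ (*-identityˡ _)) (-‿involutive _)))

  fromℤ : ℤ → F
  fromℤ (ℤ.+ n)     = n ×′ 1#
  fromℤ -[1+ n ] = - (suc n ×′ 1#)

  fromℤ-◃ : ∀ s n → fromℤ (s ℤ.◃ n) ≡ sign s * n ×′ 1#
  fromℤ-◃ s       zero    = sym (zeroʳ _)
  fromℤ-◃ Sign.+ (suc n) = sym (*-identityˡ _)
  fromℤ-◃ Sign.- (suc n) = trans (cong -_ (sym (*-identityˡ _))) (-‿distribˡ-* _ _)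

  fromℤ-signAbs : ∀ i → fromℤ i ≡ sign (ℤ.sign i) * ℤ.∣ i ∣ ×′ 1#
  fromℤ-signAbs i = trans (cong fromℤ (sym (ℤ.◃-inverse i))) (fromℤ-◃ (ℤ.sign i) ℤ.∣ i ∣)

  fromℤ-* : ∀ i j → fromℤ (i ℤ.* j) ≡ fromℤ i * fromℤ j
  fromℤ-* i j = begin
    fromℤ (i ℤ.* j)                                   ≡⟨ fromℤ-◃ (ℤ.sign i Sign.* ℤ.sign j) (∣ i ∣ ℕ.* ∣ j ∣) ⟩
    sign (ℤ.sign i Sign.* ℤ.sign j) * (∣ i ∣ ℕ.* ∣ j ∣) ×′ 1# ≡⟨ cong₂ _*_ (sign-* (ℤ.sign i) (ℤ.sign j)) (×1-homo-* ∣ i ∣ ∣ j ∣) ⟩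
    (sign (ℤ.sign i) * sign (ℤ.sign j)) * (∣ i ∣ ×′ 1# * ∣ j ∣ ×′ 1#) ≡⟨ *-interchange _ _ _ _ ⟩
    (sign (ℤ.sign i) * ∣ i ∣ ×′ 1#) * (sign (ℤ.sign j) * ∣ j ∣ ×′ 1#) ≡⟨ sym (cong₂ _*_ (fromℤ-signAbs i) (fromℤ-signAbs j)) ⟩
    fromℤ i * fromℤ j ∎
    where open ≡-Reasoning; ∣_∣ = ℤ.∣_∣

  fromℤ-neg : ∀ i → fromℤ (ℤ.- i) ≡ - fromℤ i
  fromℤ-neg -[1+ n ] = sym (-‿involutive _)
  fromℤ-neg (ℤ.+ zero)  = sym -0#≈0#
  fromℤ-neg (ℤ.+ suc n) = refl

  fromℤ-⊖ : ∀ m n → fromℤ (m ℤ.⊖ n) ≡ m ×′ 1# + - (n ×′ 1#)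
  fromℤ-⊖ zero    zero    = sym (trans (cong (0# +_) -0#≈0#) (+-identityˡ _))
  fromℤ-⊖ zero    (suc n) = sym (+-identityˡ _)
  fromℤ-⊖ (suc m) zero    = sym (trans (cong (suc m ×′ 1# +_) -0#≈0#) (+-identityʳ _))
  fromℤ-⊖ (suc m) (suc n) = begin
    fromℤ (suc m ℤ.⊖ suc n)                ≡⟨ cong fromℤ (ℤ.[1+m]⊖[1+n]≡m⊖n m n) ⟩
    fromℤ (m ℤ.⊖ n)                        ≡⟨ fromℤ-⊖ m n ⟩
    m ×′ 1# + - (n ×′ 1#)                    ≡⟨ sym (+-identityˡ _) ⟩
    0# + (m ×′ 1# + - (n ×′ 1#))             ≡⟨ cong (_+ (m ×′ 1# + - (n ×′ 1#))) (sym (-‿inverseʳ 1#)) ⟩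
    (1# + - 1#) + (m ×′ 1# + - (n ×′ 1#))    ≡⟨ +-interchange _ _ _ _ ⟩
    (1# + m ×′ 1#) + (- 1# + - (n ×′ 1#))    ≡⟨ cong₂ _+_ (sym (1+× m 1#)) (trans (-‿+-comm _ _) (cong -_ (sym (1+× n 1#)))) ⟩
    suc m ×′ 1# + - (suc n ×′ 1#)            ∎
    where open ≡-Reasoning

  fromℤ-+ : ∀ i j → fromℤ (i ℤ.+ j) ≡ fromℤ i + fromℤ j
  fromℤ-+ -[1+ m ] -[1+ n ] = begin
    - (suc (suc (m ℕ.+ n)) ×′ 1#)           ≡⟨ cong -_ (trans (1+× (suc (m ℕ.+ n)) 1#) (cong (1# +_) (×-homo-+ 1# (suc m) n))) ⟩
    - (1# + (suc m ×′ 1# + n ×′ 1#))         ≡⟨ cong -_ (x+[y+z]≡y+[x+z] 1# _ _) ⟩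
    - (suc m ×′ 1# + (1# + n ×′ 1#))         ≡⟨ cong (λ y → - (suc m ×′ 1# + y)) (sym (1+× n 1#)) ⟩
    - (suc m ×′ 1# + suc n ×′ 1#)            ≡⟨ sym (-‿+-comm _ _) ⟩
    - (suc m ×′ 1#) + - (suc n ×′ 1#)        ∎
    where open ≡-Reasoning
  fromℤ-+ -[1+ m ] (ℤ.+ n)  = trans (fromℤ-⊖ n (suc m)) (+-comm _ _)
  fromℤ-+ (ℤ.+ m) -[1+ n ]  = fromℤ-⊖ m (suc n)
  fromℤ-+ (ℤ.+ m) (ℤ.+ n)   = ×-homo-+ 1# m n

  ℤ⟶F : ℤ.+-*-rawRing ACR.-Raw-AlmostCommutative⟶ ACR.fromCommutativeRing ring
  ℤ⟶F = record
    { ⟦_⟧ = fromℤ ; +-homo = fromℤ-+ ; *-homo = fromℤ-* ; -‿homo = fromℤ-neg ; 0-homo = refl ; 1-homo = refl }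

  ℤ-≟ : ∀ i j → Maybe (fromℤ i ≡ fromℤ j)
  ℤ-≟ i j with i ℤ.≟ j
  ... | yes refl = just refl
  ... | no _     = nothing

  open import Algebra.Solver.Ring ℤ.+-*-rawRing (ACR.fromCommutativeRing ring) ℤ⟶F ℤ-≟
    using (Polynomial; solve; _:=_; con; _:+_; _:*_; :-_; _:-_)

  infix 10 #_
  #_ : ∀ {n} → ℕ → Polynomial n
  # k = con (ℤ.+ k)


  -- L ≡ R from hypotheses xᵢ ≡ yᵢ and a solver-checked certificate L = R + Σ kᵢ (xᵢ − yᵢ).
  lincomb₁ : ∀ {L R k x y} → L ≡ R + k * (x + - y) → x ≡ y → L ≡ R
  lincomb₁ {R = R} {k} {x} eq refl = trans eq (solve 3 (λ R k x → R :+ k :* (x :- x) := R) refl R k x)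

  lincomb₂ : ∀ {L R k₁ x₁ y₁ k₂ x₂ y₂} → L ≡ R + k₁ * (x₁ + - y₁) + k₂ * (x₂ + - y₂) →
             x₁ ≡ y₁ → x₂ ≡ y₂ → L ≡ R
  lincomb₂ eq e₁ e₂ = lincomb₁ (lincomb₁ eq e₂) e₁

  lincomb₃ : ∀ {L R k₁ x₁ y₁ k₂ x₂ y₂ k₃ x₃ y₃} → L ≡ R + k₁ * (x₁ + - y₁) + k₂ * (x₂ + - y₂) + k₃ * (x₃ + - y₃) →
             x₁ ≡ y₁ → x₂ ≡ y₂ → x₃ ≡ y₃ → L ≡ R
  lincomb₃ eq e₁ e₂ e₃ = lincomb₂ (lincomb₁ eq e₃) e₁ e₂

  lincomb₄ : ∀ {L R k₁ x₁ y₁ k₂ x₂ y₂ k₃ x₃ y₃ k₄ x₄ y₄} →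
             L ≡ R + k₁ * (x₁ + - y₁) + k₂ * (x₂ + - y₂) + k₃ * (x₃ + - y₃) + k₄ * (x₄ + - y₄) →
             x₁ ≡ y₁ → x₂ ≡ y₂ → x₃ ≡ y₃ → x₄ ≡ y₄ → L ≡ R
  lincomb₄ eq e₁ e₂ e₃ e₄ = lincomb₃ (lincomb₁ eq e₄) e₁ e₂ e₃


  to : F → Fin q
  to = Inverse.to card

  from : Fin q → F
  from = Inverse.from card

  to-injective : ∀ {x y} → to x ≡ to y → x ≡ y
  to-injective {x} {y} eq = trans (sym (Inverse.strictlyInverseʳ card x)) (trans (cong from eq) (Inverse.strictlyInverseʳ card y))

  infix 4 _≟_
  _≟_ : (x y : F) → Dec (x ≡ y)
  x ≟ y = map′ to-injective (cong to) (to x Fin.≟ to y)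

  inv : (x : F) → x ≢ 0# → F
  inv x x≢0 = proj₁ (inverse x x≢0)

  inverseʳ : ∀ x (x≢0 : x ≢ 0#) → x * inv x x≢0 ≡ 1#
  inverseʳ x x≢0 = proj₂ (inverse x x≢0)

  inverseˡ : ∀ x (x≢0 : x ≢ 0#) → inv x x≢0 * x ≡ 1#
  inverseˡ x x≢0 = trans (*-comm _ _) (inverseʳ x x≢0)

  x*[x⁻¹*y]≡y : ∀ x (x≢0 : x ≢ 0#) y → x * (inv x x≢0 * y) ≡ y
  x*[x⁻¹*y]≡y x x≢0 y = trans (sym (*-assoc _ _ y)) (trans (cong (_* y) (inverseʳ x x≢0)) (*-identityˡ y))

  x⁻¹*[x*y]≡y : ∀ x (x≢0 : x ≢ 0#) y → inv x x≢0 * (x * y) ≡ y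
  x⁻¹*[x*y]≡y x x≢0 y = trans (sym (*-assoc _ _ y)) (trans (cong (_* y) (inverseˡ x x≢0)) (*-identityˡ y))

  *-cancelˡ : ∀ {x y z} → x ≢ 0# → x * y ≡ x * z → y ≡ z
  *-cancelˡ {x} {y} {z} x≢0 eq = trans (sym (x⁻¹*[x*y]≡y x x≢0 y)) (trans (cong (inv x x≢0 *_) eq) (x⁻¹*[x*y]≡y x x≢0 z))

  *-cancelʳ : ∀ {x y z} → x ≢ 0# → y * x ≡ z * x → y ≡ z
  *-cancelʳ x≢0 eq = *-cancelˡ x≢0 (trans (*-comm _ _) (trans eq (*-comm _ _)))

  x*y≡0⇒x≡0⊎y≡0 : ∀ {x y} → x * y ≡ 0# → x ≡ 0# ⊎ y ≡ 0#
  x*y≡0⇒x≡0⊎y≡0 {x} {y} xy≡0 with x ≟ 0#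
  ... | yes x≡0 = inj₁ x≡0
  ... | no  x≢0 = inj₂ (*-cancelˡ x≢0 (trans xy≡0 (sym (zeroʳ x))))

  x*y≢0 : ∀ {x y} → x ≢ 0# → y ≢ 0# → x * y ≢ 0#
  x*y≢0 x≢0 y≢0 xy≡0 = [ x≢0 , y≢0 ]′ (x*y≡0⇒x≡0⊎y≡0 xy≡0)

  x*y≡1⇒x≢0 : ∀ {x y} → x * y ≡ 1# → x ≢ 0#
  x*y≡1⇒x≢0 {x} {y} xy≡1 x≡0 = 1≢0 (trans (sym xy≡1) (trans (cong (_* y) x≡0) (zeroˡ y)))

  -x≢0 : ∀ {x} → x ≢ 0# → - x ≢ 0#
  -x≢0 {x} x≢0 -x≡0 = x≢0 (trans (sym (-‿involutive x)) (trans (cong -_ -x≡0) -0#≈0#))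

  x+-y≡0⇒x≡y : ∀ {x y} → x + - y ≡ 0# → x ≡ y
  x+-y≡0⇒x≡y {x} {y} eq = begin
    x                ≡⟨ solve 2 (λ x y → x := x :- y :+ y) refl x y ⟩
    x + - y + y      ≡⟨ cong (_+ y) eq ⟩
    0# + y           ≡⟨ +-identityˡ y ⟩
    y                ∎
    where open ≡-Reasoning

  unscale : ∀ {l x y} (l≢0 : l ≢ 0#) → y ≡ l * x → x ≡ inv l l≢0 * y
  unscale {l} {x} l≢0 refl = sym (x⁻¹*[x*y]≡y l l≢0 x)

  rescale : ∀ {l m x y z} → y ≡ l * x → z ≡ m * y → z ≡ (m * l) * x
  rescale refl refl = sym (*-assoc _ _ _)

  cube≢0 : ∀ {x} → x ≢ 0# → cube x ≢ 0#
  cube≢0 x≢0 = x*y≢0 (x*y≢0 x≢0 x≢0) x≢0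

  cube-* : ∀ x y → cube (x * y) ≡ cube x * cube y
  cube-* = solve 2 (λ x y → (x :* y) :* (x :* y) :* (x :* y) := x :* x :* x :* (y :* y :* y)) refl

  cube-0 : cube 0# ≡ 0#
  cube-0 = solve 0 (# 0 :* # 0 :* # 0 := # 0) refl

  cube-1 : cube 1# ≡ 1#
  cube-1 = solve 0 (# 1 :* # 1 :* # 1 := # 1) refl

  cube≡0⇒≡0 : ∀ {x} → cube x ≡ 0# → x ≡ 0#
  cube≡0⇒≡0 {x} cube≡0 with x ≟ 0#
  ... | yes x≡0 = x≡0
  ... | no  x≢0 = ⊥-elim (cube≢0 x≢0 cube≡0)

  ratio-* : ∀ x y (y≢0 : y ≢ 0#) → x * inv y y≢0 * y ≡ x
  ratio-* x y y≢0 = trans (*-assoc _ _ _) (trans (cong (x *_) (inverseˡ y y≢0)) (*-identityʳ x))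

  cube-ratio : ∀ x y (y≢0 : y ≢ 0#) → cube x ≡ cube y → cube (x * inv y y≢0) ≡ 1#
  cube-ratio x y y≢0 eq = begin
    cube (x * inv y y≢0)            ≡⟨ cube-* x _ ⟩
    cube x * cube (inv y y≢0)       ≡⟨ cong (_* cube (inv y y≢0)) eq ⟩
    cube y * cube (inv y y≢0)       ≡⟨ sym (cube-* y _) ⟩
    cube (y * inv y y≢0)            ≡⟨ cong cube (inverseʳ y y≢0) ⟩
    cube 1#                         ≡⟨ cube-1 ⟩
    1#                              ∎
    where open ≡-Reasoning

  open import Algebra.Properties.Semiring.Exp (CommutativeRing.semiring ring)
    using (_^_; ^-assocʳ)
  open import Algebra.Properties.CommutativeSemiring.Exp (CommutativeRing.commutativeSemiring ring)
    using (^-distrib-*)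
  open import Algebra.Properties.Group +-group using (identityʳ-unique)

  1^n≡1 : ∀ n → 1# ^ n ≡ 1#
  1^n≡1 zero    = refl
  1^n≡1 (suc n) = trans (*-identityˡ _) (1^n≡1 n)

  ^3≡cube : ∀ x → x ^ 3 ≡ cube x
  ^3≡cube = solve 1 (λ x → x :* (x :* (x :* # 1)) := x :* x :* x) refl

  ^[k*3]≡cube^k : ∀ x k → x ^ (k ℕ.* 3) ≡ cube x ^ k
  ^[k*3]≡cube^k x k = begin
    x ^ (k ℕ.* 3)   ≡⟨ cong (x ^_) (ℕ.*-comm k 3) ⟩
    x ^ (3 ℕ.* k)   ≡⟨ sym (^-assocʳ x 3 k) ⟩
    (x ^ 3) ^ k     ≡⟨ cong (_^ k) (^3≡cube x) ⟩
    cube x ^ k      ∎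
    where open ≡-Reasoning

  cube-^ : ∀ x k → cube (x ^ k) ≡ cube x ^ k
  cube-^ x k = sym (trans (^-distrib-* (x * x) x k) (cong (_* x ^ k) (^-distrib-* x x k)))

  -- Counting arguments over an enumeration of F

  module Counting {n : ℕ} (enum : F ↔ Fin (suc n)) where
    private
      index : F → Fin (suc n)
      index = Inverse.to enum
      element : Fin (suc n) → F
      element = Inverse.from enum
      element-index : ∀ x → element (index x) ≡ x
      element-index = Inverse.strictlyInverseʳ enum
      index-element : ∀ i → index (element i) ≡ i
      index-element = Inverse.strictlyInverseˡ enum
      module ∑ = Sum +-commutativeMonoid
      module ∏ = Sum *-commutativeMonoid
      i₀ : Fin (suc n)
      i₀ = index 0#

    reindex : (f g : F → F) → (∀ x → f (g x) ≡ x) → (∀ x → g (f x) ≡ x) → Permutation′ (suc n)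
    reindex f g fg gf = permutation (index ∘ f ∘ element) (index ∘ g ∘ element)
      (λ i → trans (cong (index ∘ f) (element-index _)) (trans (cong index (fg _)) (index-element i)))
      (λ i → trans (cong (index ∘ g) (element-index _)) (trans (cong index (gf _)) (index-element i)))

    characteristic : suc n ×′ 1# ≡ 0#
    characteristic = identityʳ-unique X (suc n ×′ 1#) (sym (begin
      X                                    ≡⟨ ∑.sum-permute element shift ⟩
      ∑.sum (λ i → element (shift ⟨$⟩ʳ i)) ≡⟨ ∑.sum-cong-≗ (λ i → element-index (element i + 1#)) ⟩
      ∑.sum (λ i → element i + 1#)         ≡⟨ ∑.∑-distrib-+ element (λ _ → 1#) ⟩
      X + ∑.sum {suc n} (λ _ → 1#)         ≡⟨ cong (X +_) (trans (∑.sum-replicate (suc n)) (×ᵤ≈× (suc n) 1#)) ⟩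
      X + suc n ×′ 1#                      ∎))
      where
      open ≡-Reasoning
      X : F
      X = ∑.sum element
      shift : Permutation′ (suc n)
      shift = reindex (_+ 1#) (_+ - 1#)
        (solve 1 (λ x → x :- # 1 :+ # 1 := x) refl) (solve 1 (λ x → x :+ # 1 :- # 1 := x) refl)

    nonzeros : Fin n → F
    nonzeros j = element (punchIn i₀ j)

    nonzeros≢0 : ∀ j → nonzeros j ≢ 0#
    nonzeros≢0 j eq = Fin.punchInᵢ≢i i₀ j (trans (sym (index-element _)) (cong index eq))

    nonzeros-injective : ∀ i j → nonzeros i ≡ nonzeros j → i ≡ j
    nonzeros-injective i j eq = Fin.punchIn-injective i₀ i j
      (trans (sym (index-element _)) (trans (cong index eq) (index-element _)))

    ∏≢0 : ∀ {m} (f : Fin m → F) → (∀ j → f j ≢ 0#) → ∏.sum f ≢ 0#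
    ∏≢0 {zero}  f f≢0 = 1≢0
    ∏≢0 {suc m} f f≢0 = x*y≢0 (f≢0 zero) (∏≢0 (f ∘ suc) (f≢0 ∘ suc))

    -- 0↦1 removes the factor 0, so that ∏ over all of F can be compared with its image under y ↦ xy.
    fermat : ∀ x → x ≢ 0# → x ^ n ≡ 1#
    fermat x x≢0 = *-cancelʳ (∏≢0 nonzeros nonzeros≢0) (begin
      x ^ n * ∏.sum nonzeros                     ≡⟨ cong (_* ∏.sum nonzeros) (sym (∏.sum-replicate n)) ⟩
      ∏.sum {n} (λ _ → x) * ∏.sum nonzeros       ≡⟨ sym (∏.∑-distrib-+ (λ _ → x) nonzeros) ⟩
      ∏.sum (λ j → x * nonzeros j)               ≡⟨ sym (∏-0↦1 x x≢0) ⟩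
      ∏.sum (λ i → 0↦1 (x * element i))          ≡⟨ ∏.sum-cong-≗ (λ i → cong 0↦1 (sym (element-index (x * element i)))) ⟩
      ∏.sum (λ i → 0↦1 (element (scale ⟨$⟩ʳ i))) ≡⟨ sym (∏.sum-permute (0↦1 ∘ element) scale) ⟩
      ∏.sum (λ i → 0↦1 (element i))              ≡⟨ ∏.sum-cong-≗ (λ i → cong 0↦1 (sym (*-identityˡ (element i)))) ⟩
      ∏.sum (λ i → 0↦1 (1# * element i))         ≡⟨ ∏-0↦1 1# 1≢0 ⟩
      ∏.sum (λ j → 1# * nonzeros j)              ≡⟨ ∏.∑-distrib-+ (λ _ → 1#) nonzeros ⟩
      ∏.sum {n} (λ _ → 1#) * ∏.sum nonzeros      ≡⟨ cong (_* ∏.sum nonzeros) (trans (∏.sum-replicate n) (1^n≡1 n)) ⟩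
      1# * ∏.sum nonzeros                        ∎)
      where
      open ≡-Reasoning
      0↦1 : F → F
      0↦1 y with y ≟ 0#
      ... | yes _ = 1#
      ... | no  _ = y
      0↦1-0 : 0↦1 0# ≡ 1#
      0↦1-0 with 0# ≟ 0#
      ... | yes _  = refl
      ... | no 0≢0 = ⊥-elim (0≢0 refl)
      0↦1-≢0 : ∀ {y} → y ≢ 0# → 0↦1 y ≡ y
      0↦1-≢0 {y} y≢0 with y ≟ 0#
      ... | yes y≡0 = ⊥-elim (y≢0 y≡0)
      ... | no  _   = refl
      ∏-0↦1 : ∀ c → c ≢ 0# → ∏.sum (λ i → 0↦1 (c * element i)) ≡ ∏.sum (λ j → c * nonzeros j)
      ∏-0↦1 c c≢0 = begin
        ∏.sum (λ i → 0↦1 (c * element i))                     ≡⟨ ∏.sum-remove {i = i₀} (λ i → 0↦1 (c * element i)) ⟩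
        0↦1 (c * element i₀) * ∏.sum (λ j → 0↦1 (c * nonzeros j))
          ≡⟨ cong₂ _*_ c*0↦1 (∏.sum-cong-≗ λ j → 0↦1-≢0 (x*y≢0 c≢0 (nonzeros≢0 j))) ⟩
        1# * ∏.sum (λ j → c * nonzeros j)                      ≡⟨ *-identityˡ _ ⟩
        ∏.sum (λ j → c * nonzeros j)                           ∎
        where
        c*0↦1 : 0↦1 (c * element i₀) ≡ 1#
        c*0↦1 = trans (cong 0↦1 (trans (cong (c *_) (element-index 0#)) (zeroʳ c))) 0↦1-0
      scale : Permutation′ (suc n)
      scale = reindex (x *_) (inv x x≢0 *_) (x*[x⁻¹*y]≡y x x≢0) (x⁻¹*[x*y]≡y x x≢0)

  -- evalMonic (c₀ ∷ … ∷ cₘ₋₁) x = c₀ + c₁x + ⋯ + cₘ₋₁xᵐ⁻¹ + xᵐ: the leading coefficient 1 is implicit.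
  evalMonic : ∀ {m} → Vec F m → F → F
  evalMonic []       x = 1#
  evalMonic (c ∷ cs) x = c + x * evalMonic cs x

  divideBy : ∀ {m} → Vec F (suc m) → F → Vec F m
  divideBy (c ∷ [])      r = []
  divideBy (c ∷ c′ ∷ cs) r = evalMonic (c′ ∷ cs) r ∷ divideBy (c′ ∷ cs) r

  evalMonic-divideBy : ∀ {m} (p : Vec F (suc m)) r x →
    evalMonic p x ≡ (x + - r) * evalMonic (divideBy p r) x + evalMonic p r
  evalMonic-divideBy (c ∷ [])      r x =
    solve 3 (λ c r x → c :+ x :* # 1 := (x :- r) :* # 1 :+ (c :+ r :* # 1)) refl c r x
  evalMonic-divideBy (c ∷ c′ ∷ cs) r x = begin
    c + x * evalMonic (c′ ∷ cs) x                 ≡⟨ cong (λ y → c + x * y) (evalMonic-divideBy (c′ ∷ cs) r x) ⟩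
    c + x * ((x + - r) * quotient + remainder)    ≡⟨ solve 5 (λ c r x Q E → c :+ x :* ((x :- r) :* Q :+ E)
                                                       := (x :- r) :* (E :+ x :* Q) :+ (c :+ r :* E)) refl c r x quotient remainder ⟩
    (x + - r) * (remainder + x * quotient) + (c + r * remainder) ∎
    where
    open ≡-Reasoning
    quotient remainder : F
    quotient  = evalMonic (divideBy (c′ ∷ cs) r) x
    remainder = evalMonic (c′ ∷ cs) r

  roots≤degree : ∀ {m k} (p : Vec F m) (root : Fin k → F) → (∀ i j → root i ≡ root j → i ≡ j) →
                 (∀ i → evalMonic p (root i) ≡ 0#) → k ℕ.≤ m
  roots≤degree {k = zero}          p  root injective isRoot = ℕ.z≤n
  roots≤degree {zero}  {suc k}     [] root injective isRoot = ⊥-elim (1≢0 (isRoot zero))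
  roots≤degree {suc m} {suc k}     p  root injective isRoot =
    ℕ.s≤s (roots≤degree (divideBy p r) (root ∘ suc) (λ i j → Fin.suc-injective ∘ injective _ _) isRoot′)
    where
    r : F
    r = root zero
    isRoot′ : ∀ i → evalMonic (divideBy p r) (root (suc i)) ≡ 0#
    isRoot′ i with x*y≡0⇒x≡0⊎y≡0 (begin
        (x + - r) * evalMonic (divideBy p r) x            ≡⟨ sym (+-identityʳ _) ⟩
        (x + - r) * evalMonic (divideBy p r) x + 0#       ≡⟨ cong ((x + - r) * evalMonic (divideBy p r) x +_) (sym (isRoot zero)) ⟩
        (x + - r) * evalMonic (divideBy p r) x + evalMonic p r ≡⟨ sym (evalMonic-divideBy p r x) ⟩
        evalMonic p x                                     ≡⟨ isRoot (suc i) ⟩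
        0#                                                ∎)
      where open ≡-Reasoning; x = root (suc i)
    ... | inj₁ x-r≡0      = ⊥-elim (Fin.0≢1+n (injective _ _ (sym (x+-y≡0⇒x≡y x-r≡0))))
    ... | inj₂ quotient≡0 = quotient≡0

  evalMonic-replicate : ∀ m y → evalMonic (replicate m 0#) y ≡ y ^ m
  evalMonic-replicate zero    y = refl
  evalMonic-replicate (suc m) y = trans (+-identityˡ _) (cong (y *_) (evalMonic-replicate m y))

  q-pred : Σ ℕ λ n → q ≡ suc n
  q-pred = nonempty (to 0#)
    where
    nonempty : ∀ {m} → Fin m → Σ ℕ λ n → m ≡ suc n
    nonempty {suc n} _ = n , refl

  q≢1 : q ≢ 1
  q≢1 refl = 1≢0 (to-injective (all-equal (to 1#) (to 0#)))
    where
    all-equal : (i j : Fin 1) → i ≡ j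
    all-equal zero zero = refl

  enumeration : ∀ {n} → q ≡ suc n → F ↔ Fin (suc n)
  enumeration refl = card

  fermat : ∀ {n} → q ≡ suc n → ∀ x → x ≢ 0# → x ^ n ≡ 1#
  fermat q≡1+n = Counting.fermat (enumeration q≡1+n)

  characteristic : q ×′ 1# ≡ 0#
  characteristic = trans (cong (_×′ 1#) (proj₂ q-pred)) (Counting.characteristic (enumeration (proj₂ q-pred)))

  q%m×′1≡0 : ∀ m .{{_ : ℕ.NonZero m}} → m ×′ 1# ≡ 0# → (q % m) ×′ 1# ≡ 0#
  q%m×′1≡0 m m≡0 = begin
    (q % m) ×′ 1#                          ≡⟨ sym (+-identityʳ _) ⟩
    (q % m) ×′ 1# + 0#                     ≡⟨ cong ((q % m) ×′ 1# +_) (sym (trans (cong ((q / m) ×′ 1# *_) m≡0) (zeroʳ _))) ⟩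
    (q % m) ×′ 1# + (q / m) ×′ 1# * m ×′ 1# ≡⟨ cong ((q % m) ×′ 1# +_) (sym (×1-homo-* (q / m) m)) ⟩
    (q % m) ×′ 1# + (q / m ℕ.* m) ×′ 1#     ≡⟨ sym (×-homo-+ 1# (q % m) (q / m ℕ.* m)) ⟩
    (q % m ℕ.+ q / m ℕ.* m) ×′ 1#           ≡⟨ cong (_×′ 1#) (sym (m≡m%n+[m/n]*n q m)) ⟩
    q ×′ 1#                                ≡⟨ characteristic ⟩
    0#                                     ∎
    where open ≡-Reasoning

  odd⇒2≢0 : q % 2 ≡ 1 → 2# ≢ 0#
  odd⇒2≢0 q-odd 2≡0 = 1≢0 (subst (λ r → r ×′ 1# ≡ 0#) q-odd (q%m×′1≡0 2 2≡0))

  3∤q⇒3≢0 : 2# ≢ 0# → q % 3 ≡ 1 ⊎ q % 3 ≡ 2 → 3# ≢ 0#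
  3∤q⇒3≢0 2≢0 (inj₁ q%3≡1) 3≡0 = 1≢0 (subst (λ r → r ×′ 1# ≡ 0#) q%3≡1 (q%m×′1≡0 3 3≡0))
  3∤q⇒3≢0 2≢0 (inj₂ q%3≡2) 3≡0 = 2≢0 (subst (λ r → r ×′ 1# ≡ 0#) q%3≡2 (q%m×′1≡0 3 3≡0))

  q≡q%3+k*3 : q ≡ q % 3 ℕ.+ (q / 3) ℕ.* 3
  q≡q%3+k*3 = m≡m%n+[m/n]*n q 3

  -- Cubes

  module Cubes≡2mod3 (q%3≡2 : q % 3 ≡ 2) where
    private
      k : ℕ
      k = q / 3
      x*cube[x]^k≡1 : ∀ x → x ≢ 0# → x * cube x ^ k ≡ 1#
      x*cube[x]^k≡1 x x≢0 =
        trans (cong (x *_) (sym (^[k*3]≡cube^k x k))) (fermat (trans q≡q%3+k*3 (cong (ℕ._+ k ℕ.* 3) q%3≡2)) x x≢0)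

    cube≡1⇒≡1 : ∀ z → cube z ≡ 1# → z ≡ 1#
    cube≡1⇒≡1 z cube≡1 with z ≟ 0#
    ... | yes z≡0 = ⊥-elim (1≢0 (trans (sym cube≡1) (trans (cong cube z≡0) cube-0)))
    ... | no  z≢0 = begin
      z                 ≡⟨ sym (*-identityʳ z) ⟩
      z * 1#            ≡⟨ cong (z *_) (sym (1^n≡1 k)) ⟩
      z * 1# ^ k        ≡⟨ cong (λ c → z * c ^ k) (sym cube≡1) ⟩
      z * cube z ^ k    ≡⟨ x*cube[x]^k≡1 z z≢0 ⟩
      1#                ∎
      where open ≡-Reasoning

    cube-injective : ∀ x y → cube x ≡ cube y → x ≡ y
    cube-injective x y eq with y ≟ 0#
    ... | yes y≡0 = trans (cube≡0⇒≡0 (trans eq (trans (cong cube y≡0) cube-0))) (sym y≡0)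
    ... | no  y≢0 = begin
      x                    ≡⟨ sym (ratio-* x y y≢0) ⟩
      x * inv y y≢0 * y    ≡⟨ cong (_* y) (cube≡1⇒≡1 _ (cube-ratio x y y≢0 eq)) ⟩
      1# * y               ≡⟨ *-identityˡ y ⟩
      y                    ∎
      where open ≡-Reasoning

    -- For v ≢ 0 the root is v^(2k+1): its cube is v · (v^(3k+1))² = v.
    cube-root : ∀ v → Σ F λ r → cube r ≡ v
    cube-root v with v ≟ 0#
    ... | yes v≡0 = 0# , trans cube-0 (sym v≡0)
    ... | no  v≢0 = v * (v ^ k * v ^ k) , (begin
      cube (v * (v ^ k * v ^ k))                 ≡⟨ trans (cube-* v _) (cong (cube v *_) (cube-* (v ^ k) (v ^ k))) ⟩
      cube v * (cube (v ^ k) * cube (v ^ k))      ≡⟨ cong (λ c → cube v * (c * c)) (cube-^ v k) ⟩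
      cube v * (cube v ^ k * cube v ^ k)
        ≡⟨ solve 2 (λ v A → v :* v :* v :* (A :* A) := v :* (v :* A) :* (v :* A)) refl v (cube v ^ k) ⟩
      v * (v * cube v ^ k) * (v * cube v ^ k)     ≡⟨ cong (λ u → v * u * u) (x*cube[x]^k≡1 v v≢0) ⟩
      v * 1# * 1#                                 ≡⟨ solve 1 (λ v → v :* # 1 :* # 1 := v) refl v ⟩
      v                                           ∎)
      where open ≡-Reasoning

  module Cubes≡1mod3 (q%3≡1 : q % 3 ≡ 1) where
    primitive-cube-root-of-1 : Σ F λ ω → cube ω ≡ 1# × ω ≢ 1#
    primitive-cube-root-of-1 = search (q / 3) (trans q≡q%3+k*3 (cong (ℕ._+ (q / 3) ℕ.* 3) q%3≡1))
      where
      search : ∀ k → q ≡ suc (k ℕ.* 3) → Σ F λ ω → cube ω ≡ 1# × ω ≢ 1#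
      search zero    q≡1   = ⊥-elim (q≢1 q≡1)
      -- If xᵏ = 1 for all 3k nonzero x, the polynomial Yᵏ − 1 would have more than k roots.
      search (suc k) q≡1+3k = decide (Fin.any? (λ j → ¬? (nonzeros j ^ suc k ≟ 1#)))
        where
        open Counting (enumeration q≡1+3k) using (nonzeros; nonzeros≢0; nonzeros-injective)
        decide : Dec (∃ λ j → nonzeros j ^ suc k ≢ 1#) → Σ F λ ω → cube ω ≡ 1# × ω ≢ 1#
        decide (yes (j , x^k≢1)) = nonzeros j ^ suc k , cube-x^k , x^k≢1
          where
          cube-x^k : cube (nonzeros j ^ suc k) ≡ 1#
          cube-x^k = trans (cube-^ _ (suc k)) (trans (sym (^[k*3]≡cube^k _ (suc k))) (fermat q≡1+3k _ (nonzeros≢0 j)))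
        decide (no ∄) = ⊥-elim (ℕ.<⇒≱ (ℕ.s≤s (ℕ.s≤s (ℕ.≤-trans (ℕ.m≤m*n k 3) (ℕ.n≤1+n _))))
                          (roots≤degree (- 1# ∷ replicate k 0#) nonzeros nonzeros-injective isRoot))
          where
          isRoot : ∀ j → evalMonic (- 1# ∷ replicate k 0#) (nonzeros j) ≡ 0#
          isRoot j = begin
            - 1# + nonzeros j * evalMonic (replicate k 0#) (nonzeros j)
              ≡⟨ cong (λ y → - 1# + nonzeros j * y) (evalMonic-replicate k _) ⟩
            - 1# + nonzeros j ^ suc k
              ≡⟨ cong (- 1# +_) (decidable-stable (_ ≟ _) (λ x^k≢1 → ∄ (j , x^k≢1))) ⟩
            - 1# + 1#
              ≡⟨ solve 0 (:- # 1 :+ # 1 := # 0) refl ⟩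
            0# ∎
            where open ≡-Reasoning

  -- Projective equivalence, and the action of M(a,b,c,d) on the twisted cubic

  ∼-≗ : ∀ {M N} → (∀ i j → M i j ≡ N i j) → M ∼ N
  ∼-≗ M≗N = 1# , 1≢0 , λ i j → trans (sym (M≗N i j)) (sym (*-identityˡ _))

  ∼-refl : ∀ {M} → M ∼ M
  ∼-refl = ∼-≗ (λ i j → refl)

  ∼-sym : ∀ {M N} → M ∼ N → N ∼ M
  ∼-sym (l , l≢0 , N≡lM) = inv l l≢0 , x*y≡1⇒x≢0 (inverseˡ l l≢0) , λ i j → unscale l≢0 (N≡lM i j)

  ∼-trans : ∀ {M N P} → M ∼ N → N ∼ P → M ∼ P
  ∼-trans (l , l≢0 , N≡lM) (m , m≢0 , P≡mN) = m * l , x*y≢0 m≢0 l≢0 , λ i j → rescale (N≡lM i j) (P≡mN i j)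

  infix 4 _≃_
  _≃_ : Vec4 → Vec4 → Set
  x ≃ y = Σ F λ l → l ≢ 0# × (∀ j → y j ≡ l * x j)

  ≃-sym : ∀ {x y} → x ≃ y → y ≃ x
  ≃-sym (l , l≢0 , y≡lx) = inv l l≢0 , x*y≡1⇒x≢0 (inverseˡ l l≢0) , λ j → unscale l≢0 (y≡lx j)

  ≃-trans : ∀ {x y z} → x ≃ y → y ≃ z → x ≃ z
  ≃-trans (l , l≢0 , y≡lx) (m , m≢0 , z≡my) = m * l , x*y≢0 m≢0 l≢0 , λ j → rescale (y≡lx j) (z≡my j)

  ≃-pointwise : ∀ {x y} → (∀ j → x j ≡ y j) → x ≃ y
  ≃-pointwise x≗y = 1# , 1≢0 , λ j → trans (sym (x≗y j)) (sym (*-identityˡ _))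

  sum4-cong : ∀ {f g : Fin 4 → F} → (∀ i → f i ≡ g i) → sum4 f ≡ sum4 g
  sum4-cong f≗g = cong₂ _+_ (cong₂ _+_ (cong₂ _+_ (f≗g 0F) (f≗g 1F)) (f≗g 2F)) (f≗g 3F)

  ⋆-scaleˡ : ∀ {x y : Vec4} {l} → (∀ i → y i ≡ l * x i) → ∀ M j → (y ⋆ M) j ≡ l * (x ⋆ M) j
  ⋆-scaleˡ {x} {y} {l} y≡lx M j = trans (sum4-cong (λ i → cong (_* M i j) (y≡lx i)))
    (solve 9 (λ l x₀ x₁ x₂ x₃ m₀ m₁ m₂ m₃ → l :* x₀ :* m₀ :+ l :* x₁ :* m₁ :+ l :* x₂ :* m₂ :+ l :* x₃ :* m₃
                                          := l :* (x₀ :* m₀ :+ x₁ :* m₁ :+ x₂ :* m₂ :+ x₃ :* m₃))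
      refl l (x 0F) (x 1F) (x 2F) (x 3F) (M 0F j) (M 1F j) (M 2F j) (M 3F j))

  ⋆-scaleʳ : ∀ {M N : Mat4} {l} → (∀ i j → N i j ≡ l * M i j) → ∀ x j → (x ⋆ N) j ≡ l * (x ⋆ M) j
  ⋆-scaleʳ {M} {N} {l} N≡lM x j = trans (sum4-cong (λ i → cong (x i *_) (N≡lM i j)))
    (solve 9 (λ l x₀ x₁ x₂ x₃ m₀ m₁ m₂ m₃ → x₀ :* (l :* m₀) :+ x₁ :* (l :* m₁) :+ x₂ :* (l :* m₂) :+ x₃ :* (l :* m₃)
                                          := l :* (x₀ :* m₀ :+ x₁ :* m₁ :+ x₂ :* m₂ :+ x₃ :* m₃))
      refl l (x 0F) (x 1F) (x 2F) (x 3F) (M 0F j) (M 1F j) (M 2F j) (M 3F j))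

  ⋆-congˡ : ∀ {x y} M → x ≃ y → x ⋆ M ≃ y ⋆ M
  ⋆-congˡ M (l , l≢0 , y≡lx) = l , l≢0 , ⋆-scaleˡ y≡lx M

  ⋆-congʳ : ∀ {M N} x → M ∼ N → x ⋆ M ≃ x ⋆ N
  ⋆-congʳ x (l , l≢0 , N≡lM) = l , l≢0 , ⋆-scaleʳ N≡lM x

  ⋆-·ₘ : ∀ x M N j → (x ⋆ (M ·ₘ N)) j ≡ ((x ⋆ M) ⋆ N) j
  ⋆-·ₘ x M N j = solve 24
    (λ x₀ x₁ x₂ x₃ m₀₀ m₀₁ m₀₂ m₀₃ m₁₀ m₁₁ m₁₂ m₁₃ m₂₀ m₂₁ m₂₂ m₂₃ m₃₀ m₃₁ m₃₂ m₃₃ n₀ n₁ n₂ n₃ →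
         x₀ :* (m₀₀ :* n₀ :+ m₀₁ :* n₁ :+ m₀₂ :* n₂ :+ m₀₃ :* n₃)
      :+ x₁ :* (m₁₀ :* n₀ :+ m₁₁ :* n₁ :+ m₁₂ :* n₂ :+ m₁₃ :* n₃)
      :+ x₂ :* (m₂₀ :* n₀ :+ m₂₁ :* n₁ :+ m₂₂ :* n₂ :+ m₂₃ :* n₃)
      :+ x₃ :* (m₃₀ :* n₀ :+ m₃₁ :* n₁ :+ m₃₂ :* n₂ :+ m₃₃ :* n₃)
      := (x₀ :* m₀₀ :+ x₁ :* m₁₀ :+ x₂ :* m₂₀ :+ x₃ :* m₃₀) :* n₀
      :+ (x₀ :* m₀₁ :+ x₁ :* m₁₁ :+ x₂ :* m₂₁ :+ x₃ :* m₃₁) :* n₁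
      :+ (x₀ :* m₀₂ :+ x₁ :* m₁₂ :+ x₂ :* m₂₂ :+ x₃ :* m₃₂) :* n₂
      :+ (x₀ :* m₀₃ :+ x₁ :* m₁₃ :+ x₂ :* m₂₃ :+ x₃ :* m₃₃) :* n₃)
    refl (x 0F) (x 1F) (x 2F) (x 3F) (M 0F 0F) (M 0F 1F) (M 0F 2F) (M 0F 3F) (M 1F 0F) (M 1F 1F) (M 1F 2F) (M 1F 3F)
         (M 2F 0F) (M 2F 1F) (M 2F 2F) (M 2F 3F) (M 3F 0F) (M 3F 1F) (M 3F 2F) (M 3F 3F) (N 0F j) (N 1F j) (N 2F j) (N 3F j)

  private
    Mtᵖ : ∀ {n} → (a b c d : Polynomial n) → Fin 4 → Fin 4 → Polynomial n
    Mtᵖ a b c d 0F 0F = a :* a :* a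
    Mtᵖ a b c d 0F 1F = a :* a :* c
    Mtᵖ a b c d 0F 2F = a :* c :* c
    Mtᵖ a b c d 0F 3F = c :* c :* c
    Mtᵖ a b c d 1F 0F = # 3 :* a :* a :* b
    Mtᵖ a b c d 1F 1F = a :* a :* d :+ # 2 :* a :* b :* c
    Mtᵖ a b c d 1F 2F = b :* c :* c :+ # 2 :* a :* c :* d
    Mtᵖ a b c d 1F 3F = # 3 :* c :* c :* d
    Mtᵖ a b c d 2F 0F = # 3 :* a :* b :* b
    Mtᵖ a b c d 2F 1F = b :* b :* c :+ # 2 :* a :* b :* d
    Mtᵖ a b c d 2F 2F = a :* d :* d :+ # 2 :* b :* c :* d
    Mtᵖ a b c d 2F 3F = # 3 :* c :* d :* d
    Mtᵖ a b c d 3F 0F = b :* b :* b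
    Mtᵖ a b c d 3F 1F = b :* b :* d
    Mtᵖ a b c d 3F 2F = b :* d :* d
    Mtᵖ a b c d 3F 3F = d :* d :* d

    Diagᵖ : ∀ {n} → Polynomial n → Fin 4 → Fin 4 → Polynomial n
    Diagᵖ e 0F 0F = # 1
    Diagᵖ e 1F 1F = e
    Diagᵖ e 2F 2F = e :* e
    Diagᵖ e 3F 3F = e :* e :* e
    Diagᵖ e _  _  = # 0

    Cᵖ : ∀ {n} → Polynomial n → Polynomial n → Fin 4 → Polynomial n
    Cᵖ u v 0F = u :* u :* u
    Cᵖ u v 1F = u :* u :* v
    Cᵖ u v 2F = u :* v :* v
    Cᵖ u v 3F = v :* v :* v

    homogeneity : Fin 4 → Fin 4 → (t a b c d : Polynomial 5) → Polynomial 5 × Polynomial 5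
    homogeneity i j t a b c d = Mtᵖ (t :* a) (t :* b) (t :* c) (t :* d) i j := t :* t :* t :* Mtᵖ a b c d i j

    möbius : Fin 4 → (u v a b c d : Polynomial 6) → Polynomial 6 × Polynomial 6
    möbius j u v a b c d =
         Cᵖ u v 0F :* Mtᵖ a b c d 0F j :+ Cᵖ u v 1F :* Mtᵖ a b c d 1F j
      :+ Cᵖ u v 2F :* Mtᵖ a b c d 2F j :+ Cᵖ u v 3F :* Mtᵖ a b c d 3F j
      := Cᵖ (a :* u :+ b :* v) (c :* u :+ d :* v) j

    diagonality : Fin 4 → Fin 4 → (a e : Polynomial 2) → Polynomial 2 × Polynomial 2
    diagonality i j a e = Mtᵖ a (# 0) (# 0) (e :* a) i j := a :* a :* a :* Diagᵖ e i j

  Mt-homogeneous : ∀ t a b c d i j → Mt (t * a) (t * b) (t * c) (t * d) i j ≡ cube t * Mt a b c d i j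
  Mt-homogeneous t a b c d 0F 0F = solve 5 (homogeneity 0F 0F) refl t a b c d
  Mt-homogeneous t a b c d 0F 1F = solve 5 (homogeneity 0F 1F) refl t a b c d
  Mt-homogeneous t a b c d 0F 2F = solve 5 (homogeneity 0F 2F) refl t a b c d
  Mt-homogeneous t a b c d 0F 3F = solve 5 (homogeneity 0F 3F) refl t a b c d
  Mt-homogeneous t a b c d 1F 0F = solve 5 (homogeneity 1F 0F) refl t a b c d
  Mt-homogeneous t a b c d 1F 1F = solve 5 (homogeneity 1F 1F) refl t a b c d
  Mt-homogeneous t a b c d 1F 2F = solve 5 (homogeneity 1F 2F) refl t a b c d
  Mt-homogeneous t a b c d 1F 3F = solve 5 (homogeneity 1F 3F) refl t a b c d
  Mt-homogeneous t a b c d 2F 0F = solve 5 (homogeneity 2F 0F) refl t a b c d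
  Mt-homogeneous t a b c d 2F 1F = solve 5 (homogeneity 2F 1F) refl t a b c d
  Mt-homogeneous t a b c d 2F 2F = solve 5 (homogeneity 2F 2F) refl t a b c d
  Mt-homogeneous t a b c d 2F 3F = solve 5 (homogeneity 2F 3F) refl t a b c d
  Mt-homogeneous t a b c d 3F 0F = solve 5 (homogeneity 3F 0F) refl t a b c d
  Mt-homogeneous t a b c d 3F 1F = solve 5 (homogeneity 3F 1F) refl t a b c d
  Mt-homogeneous t a b c d 3F 2F = solve 5 (homogeneity 3F 2F) refl t a b c d
  Mt-homogeneous t a b c d 3F 3F = solve 5 (homogeneity 3F 3F) refl t a b c d

  Mt-diagonal : ∀ a e i j → Mt a 0# 0# (e * a) i j ≡ cube a * Diag e i j
  Mt-diagonal a e 0F 0F = solve 2 (diagonality 0F 0F) refl a e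
  Mt-diagonal a e 0F 1F = solve 2 (diagonality 0F 1F) refl a e
  Mt-diagonal a e 0F 2F = solve 2 (diagonality 0F 2F) refl a e
  Mt-diagonal a e 0F 3F = solve 2 (diagonality 0F 3F) refl a e
  Mt-diagonal a e 1F 0F = solve 2 (diagonality 1F 0F) refl a e
  Mt-diagonal a e 1F 1F = solve 2 (diagonality 1F 1F) refl a e
  Mt-diagonal a e 1F 2F = solve 2 (diagonality 1F 2F) refl a e
  Mt-diagonal a e 1F 3F = solve 2 (diagonality 1F 3F) refl a e
  Mt-diagonal a e 2F 0F = solve 2 (diagonality 2F 0F) refl a e
  Mt-diagonal a e 2F 1F = solve 2 (diagonality 2F 1F) refl a e
  Mt-diagonal a e 2F 2F = solve 2 (diagonality 2F 2F) refl a e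
  Mt-diagonal a e 2F 3F = solve 2 (diagonality 2F 3F) refl a e
  Mt-diagonal a e 3F 0F = solve 2 (diagonality 3F 0F) refl a e
  Mt-diagonal a e 3F 1F = solve 2 (diagonality 3F 1F) refl a e
  Mt-diagonal a e 3F 2F = solve 2 (diagonality 3F 2F) refl a e
  Mt-diagonal a e 3F 3F = solve 2 (diagonality 3F 3F) refl a e

  Diag-1 : ∀ i j → Diag 1# i j ≡ Id i j
  Diag-1 0F j  = refl
  Diag-1 1F j  = refl
  Diag-1 2F 0F = refl
  Diag-1 2F 1F = refl
  Diag-1 2F 2F = *-identityˡ 1#
  Diag-1 2F 3F = refl
  Diag-1 3F 0F = refl
  Diag-1 3F 1F = refl
  Diag-1 3F 2F = refl
  Diag-1 3F 3F = cube-1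

  Diag∼Mt : ∀ e → Diag e ∼ Mt 1# 0# 0# (e * 1#)
  Diag∼Mt e = cube 1# , cube≢0 1≢0 , Mt-diagonal 1# e

  -- The point of the cubic with parameter (u : v); thus P(t) = C[ t ∶ 1 ] and P(∞) = C[ 1 ∶ 0 ].
  C[_∶_] : F → F → Vec4
  C[ u ∶ v ] = vec (u * u * u) (u * u * v) (u * v * v) (v * v * v)

  C-homogeneous : ∀ l u v j → C[ l * u ∶ l * v ] j ≡ cube l * C[ u ∶ v ] j
  C-homogeneous l u v 0F = solve 3 (λ l u v → l :* u :* (l :* u) :* (l :* u) := l :* l :* l :* (u :* u :* u)) refl l u v
  C-homogeneous l u v 1F = solve 3 (λ l u v → l :* u :* (l :* u) :* (l :* v) := l :* l :* l :* (u :* u :* v)) refl l u v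
  C-homogeneous l u v 2F = solve 3 (λ l u v → l :* u :* (l :* v) :* (l :* v) := l :* l :* l :* (u :* v :* v)) refl l u v
  C-homogeneous l u v 3F = solve 3 (λ l u v → l :* v :* (l :* v) :* (l :* v) := l :* l :* l :* (v :* v :* v)) refl l u v

  C-⋆-Mt : ∀ u v a b c d j → (C[ u ∶ v ] ⋆ Mt a b c d) j ≡ C[ a * u + b * v ∶ c * u + d * v ] j
  C-⋆-Mt u v a b c d 0F = solve 6 (möbius 0F) refl u v a b c d
  C-⋆-Mt u v a b c d 1F = solve 6 (möbius 1F) refl u v a b c d
  C-⋆-Mt u v a b c d 2F = solve 6 (möbius 2F) refl u v a b c d
  C-⋆-Mt u v a b c d 3F = solve 6 (möbius 3F) refl u v a b c d

  Mt-maps-C : ∀ {a b c d u v u′ v′} l → l ≢ 0# → a * u + b * v ≡ l * u′ → c * u + d * v ≡ l * v′ →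
              C[ u ∶ v ] ⋆ Mt a b c d ≃ C[ u′ ∶ v′ ]
  Mt-maps-C {a} {b} {c} {d} {u} {v} {u′} {v′} l l≢0 eu ev = ≃-sym (cube l , cube≢0 l≢0 , λ j → begin
    (C[ u ∶ v ] ⋆ Mt a b c d) j                ≡⟨ C-⋆-Mt u v a b c d j ⟩
    C[ a * u + b * v ∶ c * u + d * v ] j       ≡⟨ cong₂ (λ x y → C[ x ∶ y ] j) eu ev ⟩
    C[ l * u′ ∶ l * v′ ] j                     ≡⟨ C-homogeneous l u′ v′ j ⟩
    cube l * C[ u′ ∶ v′ ] j                    ∎)
    where open ≡-Reasoning

  -- The line L and the classification of G_q^L

  P₁₄ P₂ : Vec4
  P₁₄ = vec 1# 0# 0# 1#
  P₂  = vec 0# 0# 1# 0#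

  OnL-eqs : Vec4 → Set
  OnL-eqs x = x 1F ≡ 0# × x 0F ≡ x 3F

  OnL⇒eqs : ∀ {x} → OnL x → OnL-eqs x
  OnL⇒eqs (l , m , x≡) = trans (x≡ 1F) (solve 2 (λ l m → l :* # 0 :+ m :* # 0 := # 0) refl l m)
                       , trans (x≡ 0F) (sym (x≡ 3F))

  eqs⇒OnL : ∀ {x} → OnL-eqs x → OnL x
  eqs⇒OnL {x} (x₁≡0 , x₀≡x₃) = x 0F , x 2F , coordinates
    where
    coordinates : ∀ i → x i ≡ x 0F * P₁₄ i + x 2F * P₂ i
    coordinates 0F = solve 2 (λ x₀ x₂ → x₀ := x₀ :* # 1 :+ x₂ :* # 0) refl (x 0F) (x 2F)
    coordinates 1F = trans x₁≡0 (solve 2 (λ x₀ x₂ → # 0 := x₀ :* # 0 :+ x₂ :* # 0) refl (x 0F) (x 2F))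
    coordinates 2F = solve 2 (λ x₀ x₂ → x₂ := x₀ :* # 0 :+ x₂ :* # 1) refl (x 0F) (x 2F)
    coordinates 3F = trans (sym x₀≡x₃) (coordinates 0F)

  OnL-≗ : ∀ {x y} → (∀ i → x i ≡ y i) → OnL x → OnL y
  OnL-≗ x≗y (l , m , x≡) = l , m , λ i → trans (sym (x≗y i)) (x≡ i)

  img₁₄ img₂ : Mat4 → Vec4
  img₁₄ M j = M 0F j + M 3F j
  img₂  M j = M 2F j

  ⋆-OnL : ∀ M {x} l m → (∀ i → x i ≡ l * P₁₄ i + m * P₂ i) → ∀ j → (x ⋆ M) j ≡ l * img₁₄ M j + m * img₂ M j
  ⋆-OnL M l m x≡ j = trans (sum4-cong (λ i → cong (_* M i j) (x≡ i)))
    (solve 6 (λ l m M₀ M₁ M₂ M₃ → (l :* # 1 :+ m :* # 0) :* M₀ :+ (l :* # 0 :+ m :* # 0) :* M₁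
                                  :+ (l :* # 0 :+ m :* # 1) :* M₂ :+ (l :* # 1 :+ m :* # 0) :* M₃
                                  := l :* (M₀ :+ M₃) :+ m :* M₂)
      refl l m (M 0F j) (M 1F j) (M 2F j) (M 3F j))

  PreservesL : Mat4 → Set
  PreservesL M = OnL-eqs (img₁₄ M) × OnL-eqs (img₂ M)

  det₂ : Mat4 → F
  det₂ M = img₁₄ M 0F * img₂ M 2F + - (img₂ M 0F * img₁₄ M 2F)

  P₁₄∈L : OnL P₁₄
  P₁₄∈L = eqs⇒OnL (refl , refl)

  P₂∈L : OnL P₂
  P₂∈L = eqs⇒OnL (refl , refl)

  P₁₄⋆ : ∀ M j → (P₁₄ ⋆ M) j ≡ img₁₄ M j
  P₁₄⋆ M j = trans (⋆-OnL M 1# 0# (proj₂ (proj₂ P₁₄∈L)) j)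
                   (solve 2 (λ A B → # 1 :* A :+ # 0 :* B := A) refl (img₁₄ M j) (img₂ M j))

  P₂⋆ : ∀ M j → (P₂ ⋆ M) j ≡ img₂ M j
  P₂⋆ M j = trans (⋆-OnL M 0# 1# (proj₂ (proj₂ P₂∈L)) j)
                  (solve 2 (λ A B → # 0 :* A :+ # 1 :* B := B) refl (img₁₄ M j) (img₂ M j))

  fixesL⇒preservesL : ∀ M → FixesL M → PreservesL M
  fixesL⇒preservesL M (into , _) = OnL⇒eqs (OnL-≗ (P₁₄⋆ M) (into P₁₄ P₁₄∈L))
                                 , OnL⇒eqs (OnL-≗ (P₂⋆ M) (into P₂ P₂∈L))

  cramer : ∀ A₀ A₂ B₀ B₂ y₀ y₂ → (D≢0 : A₀ * B₂ + - (B₀ * A₂) ≢ 0#) →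
    let D⁻¹ = inv (A₀ * B₂ + - (B₀ * A₂)) D≢0
        l = (B₂ * y₀ + - (B₀ * y₂)) * D⁻¹
        m = (A₀ * y₂ + - (A₂ * y₀)) * D⁻¹
    in l * A₀ + m * B₀ ≡ y₀ × l * A₂ + m * B₂ ≡ y₂
  cramer A₀ A₂ B₀ B₂ y₀ y₂ D≢0 =
      lincomb₁ (solve 7 (λ A₀ A₂ B₀ B₂ y₀ y₂ D⁻¹ →
        (B₂ :* y₀ :- B₀ :* y₂) :* D⁻¹ :* A₀ :+ (A₀ :* y₂ :- A₂ :* y₀) :* D⁻¹ :* B₀
        := y₀ :+ y₀ :* ((A₀ :* B₂ :- B₀ :* A₂) :* D⁻¹ :- # 1)) refl A₀ A₂ B₀ B₂ y₀ y₂ D⁻¹) D·D⁻¹≡1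
    , lincomb₁ (solve 7 (λ A₀ A₂ B₀ B₂ y₀ y₂ D⁻¹ →
        (B₂ :* y₀ :- B₀ :* y₂) :* D⁻¹ :* A₂ :+ (A₀ :* y₂ :- A₂ :* y₀) :* D⁻¹ :* B₂
        := y₂ :+ y₂ :* ((A₀ :* B₂ :- B₀ :* A₂) :* D⁻¹ :- # 1)) refl A₀ A₂ B₀ B₂ y₀ y₂ D⁻¹) D·D⁻¹≡1
    where
    D⁻¹ : F
    D⁻¹ = inv (A₀ * B₂ + - (B₀ * A₂)) D≢0
    D·D⁻¹≡1 : (A₀ * B₂ + - (B₀ * A₂)) * D⁻¹ ≡ 1#
    D·D⁻¹≡1 = inverseʳ _ D≢0

  preservesL⇒fixesL : ∀ M → PreservesL M → det₂ M ≢ 0# → FixesL M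
  preservesL⇒fixesL M ((A₁≡0 , A₀≡A₃) , (B₁≡0 , B₀≡B₃)) det≢0 = into , onto
    where
    image : ∀ l m → ∀ {x} → (∀ i → x i ≡ l * P₁₄ i + m * P₂ i) → OnL-eqs (x ⋆ M)
    image l m x≡ = trans (⋆-OnL M l m x≡ 1F) (trans (cong₂ (λ A B → l * A + m * B) A₁≡0 B₁≡0)
                                               (solve 2 (λ l m → l :* # 0 :+ m :* # 0 := # 0) refl l m))
                 , trans (⋆-OnL M l m x≡ 0F)
                         (trans (cong₂ (λ A B → l * A + m * B) A₀≡A₃ B₀≡B₃) (sym (⋆-OnL M l m x≡ 3F)))
    into : ∀ x → OnL x → OnL (x ⋆ M)
    into x (l , m , x≡) = eqs⇒OnL (image l m x≡)
    onto : ∀ y → OnL y → Σ Vec4 λ x → OnL x × (∀ i → (x ⋆ M) i ≡ y i)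
    onto y y∈L = x , (l , m , λ i → refl) , coordinates
      where
      D⁻¹ l m : F
      D⁻¹ = inv (det₂ M) det≢0
      l = (img₂ M 2F * y 0F + - (img₂ M 0F * y 2F)) * D⁻¹
      m = (img₁₄ M 0F * y 2F + - (img₁₄ M 2F * y 0F)) * D⁻¹
      x : Vec4
      x i = l * P₁₄ i + m * P₂ i
      solution : l * img₁₄ M 0F + m * img₂ M 0F ≡ y 0F × l * img₁₄ M 2F + m * img₂ M 2F ≡ y 2F
      solution = cramer (img₁₄ M 0F) (img₁₄ M 2F) (img₂ M 0F) (img₂ M 2F) (y 0F) (y 2F) det≢0
      x⋆M-eqs : OnL-eqs (x ⋆ M)
      x⋆M-eqs = image l m (λ i → refl)
      y-eqs : OnL-eqs y
      y-eqs = OnL⇒eqs y∈L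
      coordinates : ∀ i → (x ⋆ M) i ≡ y i
      coordinates 0F = trans (⋆-OnL M l m (λ i → refl) 0F) (proj₁ solution)
      coordinates 1F = trans (proj₁ x⋆M-eqs) (sym (proj₁ y-eqs))
      coordinates 2F = trans (⋆-OnL M l m (λ i → refl) 2F) (proj₂ solution)
      coordinates 3F = trans (sym (proj₂ x⋆M-eqs)) (trans (coordinates 0F) (proj₂ y-eqs))

  OnL-eqs-scale : ∀ {x y l} → (∀ j → y j ≡ l * x j) → OnL-eqs x → OnL-eqs y
  OnL-eqs-scale {l = l} y≡lx (x₁≡0 , x₀≡x₃) =
    trans (y≡lx 1F) (trans (cong (l *_) x₁≡0) (zeroʳ l)) , trans (y≡lx 0F) (trans (cong (l *_) x₀≡x₃) (sym (y≡lx 3F)))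

  preservesL-scale : ∀ {M N l} → (∀ i j → N i j ≡ l * M i j) → PreservesL M → PreservesL N
  preservesL-scale {l = l} N≡lM (A-eqs , B-eqs) =
      OnL-eqs-scale (λ j → trans (cong₂ _+_ (N≡lM 0F j) (N≡lM 3F j)) (sym (distribˡ l _ _))) A-eqs
    , OnL-eqs-scale (N≡lM 2F) B-eqs

  InGL-≗ : ∀ {M N} → (∀ i j → M i j ≡ N i j) → InGL M → InGL N
  InGL-≗ {M} {N} M≗N ((a , b , c , d , det≢0 , M∼Mt) , into , onto) =
      (a , b , c , d , det≢0 , ∼-trans (∼-≗ (λ i j → sym (M≗N i j))) M∼Mt)
    , (λ x x∈L → OnL-≗ (⋆-≗ x) (into x x∈L))
    , λ y y∈L → let (x , x∈L , x⋆M≡y) = onto y y∈L in x , x∈L , λ i → trans (sym (⋆-≗ x i)) (x⋆M≡y i)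
    where
    ⋆-≗ : ∀ x j → (x ⋆ M) j ≡ (x ⋆ N) j
    ⋆-≗ x j = sum4-cong (λ i → cong (x i *_) (M≗N i j))

  Mt-cong : ∀ {a b c d a′ b′ c′ d′} → a ≡ a′ → b ≡ b′ → c ≡ c′ → d ≡ d′ → ∀ i j → Mt a b c d i j ≡ Mt a′ b′ c′ d′ i j
  Mt-cong refl refl refl refl i j = refl

  DiagForm MtForm : Mat4 → Set
  DiagForm M = Σ F λ d → (cube d ≡ 1#) × (M ∼ Diag d)
  MtForm M = Σ F λ a → Σ F λ d → Σ F λ c →
               (2# * cube a ≡ 1#) × (2# * cube d ≡ - 1#) × (c * (a * a) ≡ - d) × (M ∼ Mt a 1# c d)

  diagonal-case : ∀ {M} a c d → a * d + - (0# * c) ≢ 0# → M ∼ Mt a 0# c d → PreservesL M → DiagForm M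
  diagonal-case {M} a c d det≢0 M∼Mt@(_ , _ , Mt≡lM) M-preserves =
    e , cube-ratio d a a≢0 (sym a³≡d³) , ∼-trans M∼Mt (∼-sym (cube a , cube≢0 a≢0 , Mt≡a³Diag))
    where
    a≢0 : a ≢ 0#
    a≢0 refl = det≢0 (solve 2 (λ d c → # 0 :* d :- # 0 :* c := # 0) refl d c)
    eqs : PreservesL (Mt a 0# c d)
    eqs = preservesL-scale Mt≡lM M-preserves
    c≡0 : c ≡ 0#
    c≡0 with x*y≡0⇒x≡0⊎y≡0
               (trans (solve 3 (λ a c d → a :* a :* c := a :* a :* c :+ # 0 :* # 0 :* d) refl a c d) (proj₁ (proj₁ eqs)))
    ... | inj₁ a²≡0 = ⊥-elim (x*y≢0 a≢0 a≢0 a²≡0)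
    ... | inj₂ c≡0  = c≡0
    a³≡d³ : cube a ≡ cube d
    a³≡d³ = lincomb₂ (solve 3 (λ a c d → a :* a :* a
                                := d :* d :* d :+ # 1 :* (a :* a :* a :+ # 0 :* # 0 :* # 0 :- (c :* c :* c :+ d :* d :* d))
                                   :+ c :* c :* (c :- # 0)) refl a c d)
              (proj₂ (proj₁ eqs)) c≡0
    e : F
    e = d * inv a a≢0
    Mt≡a³Diag : ∀ i j → Mt a 0# c d i j ≡ cube a * Diag e i j
    Mt≡a³Diag i j = trans (Mt-cong refl refl c≡0 (sym (ratio-* d a a≢0)) i j) (Mt-diagonal a e i j)

  2a³≡1⇒a≢0 : ∀ {a} → 2# * cube a ≡ 1# → a ≢ 0#
  2a³≡1⇒a≢0 {a} 2a³≡1 refl = 1≢0 (trans (sym 2a³≡1) (solve 0 (# 2 :* (# 0 :* # 0 :* # 0) := # 0) refl))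

  2d³≡-1⇒d≢0 : ∀ {d} → 2# * cube d ≡ - 1# → d ≢ 0#
  2d³≡-1⇒d≢0 {d} 2d³≡-1 refl = 1≢0 (trans (solve 0 (# 1 := :- (:- # 1)) refl)
                                    (trans (cong -_ (sym 2d³≡-1)) (solve 0 (:- (# 2 :* (# 0 :* # 0 :* # 0)) := # 0) refl)))

  c≡-2ad : ∀ {a c d} → 2# * cube a ≡ 1# → c * (a * a) ≡ - d → c ≡ - (2# * a * d)
  c≡-2ad {a} {c} {d} = lincomb₂ (solve 3 (λ a c d →
    c := :- (# 2 :* a :* d) :+ (:- c) :* (# 2 :* (a :* a :* a) :- # 1) :+ # 2 :* a :* (c :* (a :* a) :- :- d)) refl a c d)

  module Classification (3≢0 : 3# ≢ 0#) where

    normal-form : ∀ a c d → PreservesL (Mt a 1# c d) → d ≢ 0# →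
                  2# * cube a ≡ 1# × 2# * cube d ≡ - 1# × c * (a * a) ≡ - d
    normal-form a c d ((E₁ , _) , (E₃ , E₄)) d≢0 = 2a³≡1 , 2d³≡-1 , c·a²≡-d
      where
      d·[2a³-1]≡0 : d * (2# * cube a + - 1#) ≡ 0#
      d·[2a³-1]≡0 = lincomb₂ (solve 3 (λ a c d → d :* (# 2 :* (a :* a :* a) :- # 1)
        := # 0 :+ (:- # 1) :* (a :* a :* c :+ # 1 :* # 1 :* d :- # 0) :+ a :* a :* (# 1 :* # 1 :* c :+ # 2 :* a :* # 1 :* d :- # 0))
        refl a c d) E₁ E₃
      2a³≡1 : 2# * cube a ≡ 1#
      2a³≡1 = [ ⊥-elim ∘ d≢0 , x+-y≡0⇒x≡y ]′ (x*y≡0⇒x≡0⊎y≡0 d·[2a³-1]≡0)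
      3·a·[1+2d³]≡0 : 3# * (a * (1# + 2# * cube d)) ≡ 0#
      3·a·[1+2d³]≡0 = lincomb₂ (solve 3 (λ a c d → # 3 :* (a :* (# 1 :+ # 2 :* (d :* d :* d)))
        := # 0 :+ # 1 :* (# 3 :* a :* # 1 :* # 1 :- # 3 :* c :* d :* d) :+ # 3 :* d :* d :* (# 1 :* # 1 :* c :+ # 2 :* a :* # 1 :* d :- # 0))
        refl a c d) E₄ E₃
      1+2d³≡0 : 1# + 2# * cube d ≡ 0#
      1+2d³≡0 = [ ⊥-elim ∘ 3≢0 , [ ⊥-elim ∘ 2a³≡1⇒a≢0 2a³≡1 , (λ e → e) ]′ ∘ x*y≡0⇒x≡0⊎y≡0 ]′
                  (x*y≡0⇒x≡0⊎y≡0 3·a·[1+2d³]≡0)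
      2d³≡-1 : 2# * cube d ≡ - 1#
      2d³≡-1 = lincomb₁ (solve 1 (λ d → # 2 :* (d :* d :* d) := :- # 1 :+ # 1 :* (# 1 :+ # 2 :* (d :* d :* d) :- # 0)) refl d) 1+2d³≡0
      c·a²≡-d : c * (a * a) ≡ - d
      c·a²≡-d = lincomb₁ (solve 3 (λ a c d → c :* (a :* a) := :- d :+ # 1 :* (a :* a :* c :+ # 1 :* # 1 :* d :- # 0)) refl a c d) E₁

    general-case : ∀ {M} a b c d → b ≢ 0# → a * d + - (b * c) ≢ 0# → M ∼ Mt a b c d → PreservesL M → MtForm M
    general-case {M} a b c d b≢0 det≢0 M∼Mt M-preserves =
      let (2a′³≡1 , 2d′³≡-1 , c′a′²≡-d′) = normal-form a′ c′ d′ eqs d′≢0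
      in  a′ , d′ , c′ , 2a′³≡1 , 2d′³≡-1 , c′a′²≡-d′ , M∼Mt′
      where
      b⁻¹ a′ c′ d′ : F
      b⁻¹ = inv b b≢0
      a′ = b⁻¹ * a
      c′ = b⁻¹ * c
      d′ = b⁻¹ * d
      b·b⁻¹x : ∀ x → b * (b⁻¹ * x) ≡ x
      b·b⁻¹x = x*[x⁻¹*y]≡y b b≢0
      Mt′∼Mt : Mt a′ 1# c′ d′ ∼ Mt a b c d
      Mt′∼Mt = cube b , cube≢0 b≢0 , λ i j →
        trans (Mt-cong (sym (b·b⁻¹x a)) (sym (*-identityʳ b)) (sym (b·b⁻¹x c)) (sym (b·b⁻¹x d)) i j)
              (Mt-homogeneous b a′ 1# c′ d′ i j)
      M∼Mt′ : M ∼ Mt a′ 1# c′ d′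
      M∼Mt′ = ∼-trans M∼Mt (∼-sym Mt′∼Mt)
      eqs : PreservesL (Mt a′ 1# c′ d′)
      eqs = preservesL-scale (proj₂ (proj₂ M∼Mt′)) M-preserves
      d′≢0 : d′ ≢ 0#
      d′≢0 d′≡0 = det≢0 (trans (cong₂ (λ x y → a * x + - (b * y)) (sym (b·b⁻¹x d)) (sym (b·b⁻¹x c)))
        (lincomb₂ (solve 4 (λ a b c′ d′ → a :* (b :* d′) :- b :* (b :* c′)
                                         := # 0 :+ a :* b :* (d′ :- # 0) :+ (:- (b :* b)) :* (c′ :- # 0))
                     refl a b c′ d′) d′≡0 c′≡0))
        where
        c′≡0 : c′ ≡ 0#
        c′≡0 = lincomb₂ (solve 3 (λ a′ c′ d′ → c′ := # 0 :+ # 1 :* (# 1 :* # 1 :* c′ :+ # 2 :* a′ :* # 1 :* d′ :- # 0)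
                                                   :+ (:- (# 2 :* a′)) :* (d′ :- # 0))
                          refl a′ c′ d′) (proj₁ (proj₂ eqs)) d′≡0

    classify : ∀ M → InGL M → DiagForm M ⊎ MtForm M
    classify M ((a , b , c , d , det≢0 , M∼Mt) , fixes) with b ≟ 0#
    ... | yes refl = inj₁ (diagonal-case a c d det≢0 M∼Mt (fixesL⇒preservesL M fixes))
    ... | no  b≢0  = inj₂ (general-case a b c d b≢0 det≢0 M∼Mt (fixesL⇒preservesL M fixes))

    Mt∈GL : ∀ a d → 2# * cube a ≡ 1# → 2# * cube d ≡ - 1# → InGL (Mt a 1# (- (2# * a * d)) d)
    Mt∈GL a d 2a³≡1 2d³≡-1 = (a , 1# , c , d , det≢0 , ∼-refl) , preservesL⇒fixesL (Mt a 1# c d) preserves det₂≢0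
      where
      c : F
      c = - (2# * a * d)
      a≢0 : a ≢ 0#
      a≢0 = 2a³≡1⇒a≢0 2a³≡1
      d≢0 : d ≢ 0#
      d≢0 = 2d³≡-1⇒d≢0 2d³≡-1
      det≢0 : a * d + - (1# * c) ≢ 0#
      det≢0 det≡0 = x*y≢0 3≢0 (x*y≢0 a≢0 d≢0)
        (trans (solve 2 (λ a d → # 3 :* (a :* d) := a :* d :- # 1 :* (:- (# 2 :* a :* d))) refl a d) det≡0)
      preserves : PreservesL (Mt a 1# c d)
      preserves =
          ( lincomb₁ (solve 2 (λ a d → a :* a :* (:- (# 2 :* a :* d)) :+ # 1 :* # 1 :* d
                                       := # 0 :+ (:- d) :* (# 2 :* (a :* a :* a) :- # 1)) refl a d) 2a³≡1
          , lincomb₂ (solve 2 (λ a d → a :* a :* a :+ # 1 :* # 1 :* # 1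
                                       := (:- (# 2 :* a :* d)) :* (:- (# 2 :* a :* d)) :* (:- (# 2 :* a :* d)) :+ d :* d :* d
                                          :+ (d :* d :* d :- # 1) :* (# 2 :* (a :* a :* a) :- # 1)
                                          :+ # 3 :* (a :* a :* a) :* (# 2 :* (d :* d :* d) :- :- # 1)) refl a d) 2a³≡1 2d³≡-1 )
        , ( solve 2 (λ a d → # 1 :* # 1 :* (:- (# 2 :* a :* d)) :+ # 2 :* a :* # 1 :* d := # 0) refl a d
          , lincomb₁ (solve 2 (λ a d → # 3 :* a :* # 1 :* # 1
                                       := # 3 :* (:- (# 2 :* a :* d)) :* d :* d :+ # 3 :* a :* (# 2 :* (d :* d :* d) :- :- # 1)) refl a d)
                     2d³≡-1 )
      2det₂≡-27ad² : 2# * det₂ (Mt a 1# c d) ≡ - (3# * 3# * 3# * a * d * d)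
      2det₂≡-27ad² = lincomb₁ (solve 2 (λ a d → let c = :- (# 2 :* a :* d) in
          # 2 :* ((a :* a :* a :+ # 1 :* # 1 :* # 1) :* (a :* d :* d :+ # 2 :* # 1 :* c :* d)
                  :- # 3 :* a :* # 1 :* # 1 :* (a :* c :* c :+ # 1 :* d :* d))
          := :- (# 3 :* # 3 :* # 3 :* a :* d :* d) :+ (:- (# 15 :* a :* d :* d)) :* (# 2 :* (a :* a :* a) :- # 1))
        refl a d) 2a³≡1
      det₂≢0 : det₂ (Mt a 1# c d) ≢ 0#
      det₂≢0 det₂≡0 = x*y≢0 (x*y≢0 (x*y≢0 (x*y≢0 (x*y≢0 3≢0 3≢0) 3≢0) a≢0) d≢0) d≢0 (begin
        3# * 3# * 3# * a * d * d        ≡⟨ sym (-‿involutive _) ⟩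
        - - (3# * 3# * 3# * a * d * d)  ≡⟨ cong -_ (sym 2det₂≡-27ad²) ⟩
        - (2# * det₂ (Mt a 1# c d))     ≡⟨ cong (λ D → - (2# * D)) det₂≡0 ⟩
        - (2# * 0#)                     ≡⟨ solve 0 (:- (# 2 :* # 0) := # 0) refl ⟩
        0#                              ∎)
        where open ≡-Reasoning

    Diag∈GL : ∀ d → cube d ≡ 1# → InGL (Diag d)
    Diag∈GL d d³≡1 = (1# , 0# , 0# , d * 1# , det≢0 , Diag∼Mt d)
                   , preservesL⇒fixesL (Diag d) preserves det₂≢0
      where
      d≢0 : d ≢ 0#
      d≢0 refl = 1≢0 (trans (sym d³≡1) cube-0)
      det≢0 : 1# * (d * 1#) + - (0# * 0#) ≢ 0#
      det≢0 det≡0 = d≢0 (trans (solve 1 (λ d → d := # 1 :* (d :* # 1) :- # 0 :* # 0) refl d) det≡0)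
      preserves : PreservesL (Diag d)
      preserves = ( +-identityˡ 0#
                  , lincomb₁ (solve 1 (λ d → # 1 :+ # 0 := # 0 :+ d :* d :* d :+ (:- # 1) :* (d :* d :* d :- # 1)) refl d) d³≡1 )
                , (refl , refl)
      det₂≢0 : det₂ (Diag d) ≢ 0#
      det₂≢0 det₂≡0 = x*y≢0 d≢0 d≢0
        (trans (solve 1 (λ d → d :* d := (# 1 :+ # 0) :* (d :* d) :- # 0 :* (# 0 :+ # 0)) refl d) det₂≡0)

    Id∈GL : InGL Id
    Id∈GL = InGL-≗ Diag-1 (Diag∈GL 1# cube-1)

  part-i : q % 2 ≡ 1 → q % 3 ≡ 2 →
      (∀ x y → cube x ≡ cube y → x ≡ y)
    × (Σ F λ a → Σ F λ c → (2# * cube a ≡ 1#) × (cube c ≡ 2#))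
    × (∀ a c → 2# * cube a ≡ 1# → cube c ≡ 2# → Enumerates (pair Id (Mt a 1# c (- a))))
  part-i q-odd q%3≡2 = cube-injective , roots , enumerate
    where
    open Cubes≡2mod3 q%3≡2
    2≢0 : 2# ≢ 0#
    2≢0 = odd⇒2≢0 q-odd
    open Classification (3∤q⇒3≢0 2≢0 (inj₂ q%3≡2))

    roots : Σ F λ a → Σ F λ c → (2# * cube a ≡ 1#) × (cube c ≡ 2#)
    roots = let (a , a³≡½) = cube-root (inv 2# 2≢0) ; (c , c³≡2) = cube-root 2#
            in a , c , trans (cong (2# *_) a³≡½) (inverseʳ 2# 2≢0) , c³≡2

    enumerate : ∀ a c → 2# * cube a ≡ 1# → cube c ≡ 2# → Enumerates (pair Id (Mt a 1# c (- a)))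
    enumerate a c 2a³≡1 c³≡2 = members , distinct , cover
      where
      2[-a]³≡-1 : 2# * cube (- a) ≡ - 1#
      2[-a]³≡-1 = lincomb₁ (solve 1 (λ a → # 2 :* (:- a :* :- a :* :- a) := :- # 1 :+ (:- # 1) :* (# 2 :* (a :* a :* a) :- # 1)) refl a) 2a³≡1
      c≡-2a[-a] : c ≡ - (2# * a * - a)
      c≡-2a[-a] = cube-injective c _ (trans c³≡2 (sym (lincomb₁ (solve 1 (λ a →
        :- (# 2 :* a :* :- a) :* :- (# 2 :* a :* :- a) :* :- (# 2 :* a :* :- a)
        := # 2 :+ (# 2 :+ # 4 :* (a :* a :* a)) :* (# 2 :* (a :* a :* a) :- # 1)) refl a) 2a³≡1)))
      members : ∀ i → InGL (pair Id (Mt a 1# c (- a)) i)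
      members 0F = Id∈GL
      members 1F = subst (λ c → InGL (Mt a 1# c (- a))) (sym c≡-2a[-a]) (Mt∈GL a (- a) 2a³≡1 2[-a]³≡-1)
      distinct : ∀ i j → pair Id (Mt a 1# c (- a)) i ∼ pair Id (Mt a 1# c (- a)) j → i ≡ j
      distinct 0F 0F _ = refl
      distinct 0F 1F (l , _ , Mt≡l·Id) = ⊥-elim (1≢0 (trans (sym cube-1) (trans (Mt≡l·Id 3F 0F) (zeroʳ l))))
      distinct 1F 0F (l , l≢0 , Id≡l·Mt) =
        ⊥-elim (l≢0 (trans (sym (*-identityʳ l)) (trans (cong (l *_) (sym cube-1)) (sym (Id≡l·Mt 3F 0F)))))
      distinct 1F 1F _ = refl
      cover : ∀ M → InGL M → Σ (Fin 2) λ i → M ∼ pair Id (Mt a 1# c (- a)) i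
      cover M M∈GL = [ from-diag , from-mt ]′ (classify M M∈GL)
        where
        from-diag : DiagForm M → Σ (Fin 2) λ i → M ∼ pair Id (Mt a 1# c (- a)) i
        from-diag (d , d³≡1 , M∼Diag) =
          0F , ∼-trans (subst (λ d → M ∼ Diag d) (cube-injective d 1# (trans d³≡1 (sym cube-1))) M∼Diag) (∼-≗ Diag-1)
        from-mt : MtForm M → Σ (Fin 2) λ i → M ∼ pair Id (Mt a 1# c (- a)) i
        from-mt (a′ , d′ , c′ , 2a′³≡1 , 2d′³≡-1 , c′a′²≡-d′ , M∼Mt) =
          1F , ∼-trans M∼Mt (∼-≗ (Mt-cong a′≡a refl c′≡c d′≡-a))
          where
          a′≡a : a′ ≡ a
          a′≡a = cube-injective a′ a (*-cancelˡ 2≢0 (trans 2a′³≡1 (sym 2a³≡1)))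
          d′≡-a : d′ ≡ - a
          d′≡-a = cube-injective d′ (- a) (*-cancelˡ 2≢0 (trans 2d′³≡-1 (sym 2[-a]³≡-1)))
          c′≡c : c′ ≡ c
          c′≡c = trans (c≡-2ad 2a′³≡1 c′a′²≡-d′) (trans (cong₂ (λ x y → - (2# * x * y)) a′≡a d′≡-a) (sym c≡-2a[-a]))

  module Tetrahedral (2≢0 : 2# ≢ 0#) (3≢0 : 3# ≢ 0#) (t : F) (2t³≡-1 : 2# * cube t ≡ - 1#)
                     (ω : F) (ω³≡1 : cube ω ≡ 1#) (ω≢1 : ω ≢ 1#) where
    open Classification 3≢0

    w : Fin 3 → F
    w 0F = 1#
    w 1F = ω
    w 2F = ω * ω

    w-⊕ : ∀ i j → w i * w j ≡ w (i ⊕ j)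
    w-⊕ 0F j  = *-identityˡ (w j)
    w-⊕ 1F 0F = *-identityʳ ω
    w-⊕ 1F 1F = refl
    w-⊕ 1F 2F = trans (sym (*-assoc ω ω ω)) ω³≡1
    w-⊕ 2F 0F = *-identityʳ (ω * ω)
    w-⊕ 2F 1F = ω³≡1
    w-⊕ 2F 2F = lincomb₁ (solve 1 (λ ω → ω :* ω :* (ω :* ω) := ω :+ ω :* (ω :* ω :* ω :- # 1)) refl ω) ω³≡1

    w-⊕-⊕ : ∀ i j → w ((i ⊕ j) ⊕ (i ⊕ j)) ≡ w i * w j * (w i * w j)
    w-⊕-⊕ i j = sym (trans (cong₂ _*_ (w-⊕ i j) (w-⊕ i j)) (w-⊕ (i ⊕ j) (i ⊕ j)))

    w-cube : ∀ i → cube (w i) ≡ 1#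
    w-cube 0F = cube-1
    w-cube 1F = ω³≡1
    w-cube 2F = lincomb₁ (solve 1 (λ ω → ω :* ω :* (ω :* ω) :* (ω :* ω)
                                      := # 1 :+ (# 1 :+ ω :* ω :* ω) :* (ω :* ω :* ω :- # 1)) refl ω) ω³≡1

    w≢0 : ∀ i → w i ≢ 0#
    w≢0 i w≡0 = 1≢0 (trans (sym (w-cube i)) (trans (cong cube w≡0) cube-0))

    ω²+ω+1≡0 : ω * ω + ω + 1# ≡ 0#
    ω²+ω+1≡0 = [ ⊥-elim ∘ ω≢1 ∘ x+-y≡0⇒x≡y , (λ e → e) ]′ (x*y≡0⇒x≡0⊎y≡0
      (lincomb₁ (solve 1 (λ ω → (ω :- # 1) :* (ω :* ω :+ ω :+ # 1) := # 0 :+ # 1 :* (ω :* ω :* ω :- # 1)) refl ω) ω³≡1))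

    w-quadratic : ∀ m → w (suc m) * w (suc m) + w (suc m) + 1# ≡ 0#
    w-quadratic 0F = ω²+ω+1≡0
    w-quadratic 1F = lincomb₂ (solve 1 (λ ω → ω :* ω :* (ω :* ω) :+ ω :* ω :+ # 1
                                     := # 0 :+ ω :* (ω :* ω :* ω :- # 1) :+ # 1 :* (ω :* ω :+ ω :+ # 1 :- # 0)) refl ω)
                            ω³≡1 ω²+ω+1≡0

    w[1+m]≢1 : ∀ m → w (suc m) ≢ 1#
    w[1+m]≢1 m W≡1 = 3≢0 (trans (solve 0 (# 3 := # 1 :* # 1 :+ # 1 :+ # 1) refl)
                              (trans (cong (λ W → W * W + W + 1#) (sym W≡1)) (w-quadratic m)))

    w-injective : ∀ i j → w i ≡ w j → i ≡ j
    w-injective 0F 0F _ = refl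
    w-injective 0F 1F e = ⊥-elim (ω≢1 (sym e))
    w-injective 0F 2F e = ⊥-elim (w[1+m]≢1 1F (sym e))
    w-injective 1F 0F e = ⊥-elim (ω≢1 e)
    w-injective 1F 1F _ = refl
    w-injective 1F 2F e = ⊥-elim (ω≢1 (sym (*-cancelˡ (w≢0 1F) (trans (*-identityʳ ω) e))))
    w-injective 2F 0F e = ⊥-elim (w[1+m]≢1 1F e)
    w-injective 2F 1F e = ⊥-elim (ω≢1 (sym (*-cancelˡ (w≢0 1F) (trans (*-identityʳ ω) (sym e)))))
    w-injective 2F 2F _ = refl

    cube≡1⇒w : ∀ x → cube x ≡ 1# → Σ (Fin 3) λ k → x ≡ w k
    cube≡1⇒w x x³≡1 with x ≟ 1# | x ≟ ω
    ... | yes x≡1 | _       = 0F , x≡1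
    ... | no  _   | yes x≡ω = 1F , x≡ω
    ... | no  x≢1 | no  x≢ω = 2F , [ [ ⊥-elim ∘ x≢1 ∘ x+-y≡0⇒x≡y , ⊥-elim ∘ x≢ω ∘ x+-y≡0⇒x≡y ]′ ∘ x*y≡0⇒x≡0⊎y≡0
                                   , x+-y≡0⇒x≡y ]′ (x*y≡0⇒x≡0⊎y≡0 roots)
      where
      roots : (x + - 1#) * (x + - ω) * (x + - (ω * ω)) ≡ 0#
      roots = lincomb₃ (solve 2 (λ x ω → (x :- # 1) :* (x :- ω) :* (x :- ω :* ω)
                := # 0 :+ # 1 :* (x :* x :* x :- # 1) :+ (x :- # 1) :* (ω :* ω :* ω :- # 1) :+ (x :- x :* x) :* (ω :* ω :+ ω :+ # 1 :- # 0))
                refl x ω) x³≡1 ω³≡1 ω²+ω+1≡0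

    t≢0 : t ≢ 0#
    t≢0 = 2d³≡-1⇒d≢0 2t³≡-1

    a[_] d[_] : Fin 3 → F
    a[ i ] = - t * w i
    d[ j ] = t * w j

    canonical : Kind → Mat4
    canonical (diag m) = Diag (w m)
    canonical (mt i j) = Mt a[ i ] 1# (- (2# * a[ i ] * d[ j ])) d[ j ]

    canonical∈GL : ∀ K → InGL (canonical K)
    canonical∈GL (diag m) = Diag∈GL (w m) (w-cube m)
    canonical∈GL (mt i j) = Mt∈GL a[ i ] d[ j ]
      (lincomb₂ (solve 2 (λ t x → # 2 :* (:- t :* x :* (:- t :* x) :* (:- t :* x))
                         := # 1 :+ (:- (x :* x :* x)) :* (# 2 :* (t :* t :* t) :- :- # 1) :+ # 1 :* (x :* x :* x :- # 1))
                  refl t (w i)) 2t³≡-1 (w-cube i))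
      (lincomb₂ (solve 2 (λ t x → # 2 :* (t :* x :* (t :* x) :* (t :* x))
                         := :- # 1 :+ x :* x :* x :* (# 2 :* (t :* t :* t) :- :- # 1) :+ (:- # 1) :* (x :* x :* x :- # 1))
                  refl t (w j)) 2t³≡-1 (w-cube j))

    s : Fin 3 → F
    s k = t * t * w k

    pt : Fin 4 → Vec4
    pt 0F       = C[ 1# ∶ 0# ]
    pt (suc k)  = C[ s k ∶ 1# ]

    pt-injective : ∀ x y → pt x ≃ pt y → x ≡ y
    pt-injective 0F      0F       _ = refl
    pt-injective 0F      (suc k)  (l , _ , y≡lx) =
      ⊥-elim (1≢0 (trans (sym cube-1) (trans (y≡lx 3F) (trans (cong (l *_) cube-0) (zeroʳ l)))))
    pt-injective (suc k) 0F       (l , l≢0 , y≡lx) =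
      ⊥-elim (l≢0 (trans (sym (*-identityʳ l)) (trans (cong (l *_) (sym cube-1)) (trans (sym (y≡lx 3F)) cube-0))))
    pt-injective (suc k) (suc k′) (l , _ , y≡lx) = cong suc (sym (w-injective k′ k (*-cancelˡ (x*y≢0 t≢0 t≢0) s′≡s)))
      where
      l≡1 : l ≡ 1#
      l≡1 = trans (sym (*-identityʳ l)) (trans (cong (l *_) (sym cube-1)) (sym (trans (sym cube-1) (y≡lx 3F))))
      s′≡s : s k′ ≡ s k
      s′≡s = begin
        s k′                 ≡⟨ solve 1 (λ x → x := x :* # 1 :* # 1) refl (s k′) ⟩
        s k′ * 1# * 1#       ≡⟨ y≡lx 2F ⟩
        l * (s k * 1# * 1#)  ≡⟨ cong (_* (s k * 1# * 1#)) l≡1 ⟩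
        1# * (s k * 1# * 1#) ≡⟨ solve 1 (λ x → # 1 :* (x :* # 1 :* # 1) := x) refl (s k) ⟩
        s k                  ∎
        where open ≡-Reasoning

    -- The Möbius map of mt i j sends t²ωᵏ to ∞ if ωⁱ⁺ᵏ = 1, and otherwise to t²(ωʲW)² with
    -- W = ωⁱ⁺ᵏ, using W² + W + 1 = 0.
    mt-moves : ∀ i j k m → i ⊕ k ≡ m → pt (suc k) ⋆ canonical (mt i j) ≃ pt (mt-image j m)
    mt-moves i j k 0F i⊕k≡0 = Mt-maps-C A A≢0 (sym (*-identityʳ A)) (trans B≡0 (sym (zeroʳ A)))
      where
      A : F
      A = a[ i ] * s k + 1# * 1#
      xz≡1 : w i * w k ≡ 1#
      xz≡1 = trans (w-⊕ i k) (cong w i⊕k≡0)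
      B≡0 : - (2# * a[ i ] * d[ j ]) * s k + d[ j ] * 1# ≡ 0#
      B≡0 = lincomb₂ (solve 4 (λ t x y z → :- (# 2 :* (:- t :* x) :* (t :* y)) :* (t :* t :* z) :+ t :* y :* # 1
                                 := # 0 :+ t :* y :* (# 2 :* (t :* t :* t) :- :- # 1) :+ # 2 :* t :* t :* t :* t :* y :* (x :* z :- # 1))
                       refl t (w i) (w j) (w k)) 2t³≡-1 xz≡1
      A≢0 : A ≢ 0#
      A≢0 A≡0 = 3≢0 (trans (sym (lincomb₂ (solve 3 (λ t x z → # 2 :* (:- t :* x :* (t :* t :* z) :+ # 1 :* # 1)
                                               := # 3 :+ (:- (x :* z)) :* (# 2 :* (t :* t :* t) :- :- # 1) :+ # 1 :* (x :* z :- # 1))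
                                     refl t (w i) (w k)) 2t³≡-1 xz≡1))
                     (trans (cong (2# *_) A≡0) (zeroʳ 2#)))
    mt-moves i j k (suc m) i⊕k≡W = Mt-maps-C B B≢0 A≡B·s′ (sym (*-identityʳ B))
      where
      W A B : F
      W = w (suc m)
      A = a[ i ] * s k + 1# * 1#
      B = - (2# * a[ i ] * d[ j ]) * s k + d[ j ] * 1#
      xz≡W : w i * w k ≡ W
      xz≡W = trans (w-⊕ i k) (cong w i⊕k≡W)
      B≡ty[1-W] : B ≡ t * w j * (1# + - W)
      B≡ty[1-W] = lincomb₂ (solve 5 (λ t x y z W → :- (# 2 :* (:- t :* x) :* (t :* y)) :* (t :* t :* z) :+ t :* y :* # 1
                                 := t :* y :* (# 1 :- W) :+ t :* y :* W :* (# 2 :* (t :* t :* t) :- :- # 1)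
                                    :+ # 2 :* t :* t :* t :* t :* y :* (x :* z :- W))
                            refl t (w i) (w j) (w k) W) 2t³≡-1 xz≡W
      B≢0 : B ≢ 0#
      B≢0 B≡0 = x*y≢0 (x*y≢0 t≢0 (w≢0 j)) (λ 1-W≡0 → w[1+m]≢1 m (sym (x+-y≡0⇒x≡y 1-W≡0))) (trans (sym B≡ty[1-W]) B≡0)
      A≡B·s′ : A ≡ B * s ((j ⊕ suc m) ⊕ (j ⊕ suc m))
      A≡B·s′ = trans (lincomb₄ (solve 5 (λ t x y z W →
                 :- t :* x :* (t :* t :* z) :+ # 1 :* # 1
                 := (:- (# 2 :* (:- t :* x) :* (t :* y)) :* (t :* t :* z) :+ t :* y :* # 1) :* (t :* t :* (y :* W :* (y :* W)))
                    :+ (# 1 :- t :* t :* t :* (W :* W :* W)) :* (# 2 :* (t :* t :* t) :- :- # 1)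
                    :+ (:- (t :* t :* t) :- # 2 :* (t :* t :* t) :* (t :* t :* t) :* W :* W) :* (x :* z :- W)
                    :+ (:- (# 2 :* (t :* t :* t) :* (t :* t :* t) :* x :* z :* W :* W) :- t :* t :* t :* W :* W) :* (y :* y :* y :- # 1)
                    :+ t :* t :* t :* (W :- # 2) :* (W :* W :+ W :+ # 1 :- # 0))
                 refl t (w i) (w j) (w k) W) 2t³≡-1 xz≡W (w-cube j) (w-quadratic m))
               (cong (λ v → B * (t * t * v)) (sym (w-⊕-⊕ j (suc m))))

    canonical-act : ∀ K x → pt x ⋆ canonical K ≃ pt (act K x)
    canonical-act (diag m) 0F = ≃-trans (⋆-congʳ (pt 0F) (Diag∼Mt (w m))) (Mt-maps-C 1# 1≢0
      (solve 0 (# 1 :* # 1 :+ # 0 :* # 0 := # 1 :* # 1) refl)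
      (solve 1 (λ e → # 0 :* # 1 :+ e :* # 1 :* # 0 := # 1 :* # 0) refl (w m)))
    canonical-act (diag m) (suc k) = ≃-trans (⋆-congʳ (pt (suc k)) (Diag∼Mt (w m))) (Mt-maps-C (w m) (w≢0 m)
      (trans (lincomb₁ (solve 3 (λ t z e → # 1 :* (t :* t :* z) :+ # 0 :* # 1
                                   := e :* (t :* t :* (z :* (e :* e))) :+ (:- (t :* t :* z)) :* (e :* e :* e :- # 1))
                         refl t (w k) (w m)) (w-cube m))
             (cong (λ v → w m * (t * t * v)) (trans (cong (w k *_) (w-⊕ m m)) (w-⊕ k (m ⊕ m)))))
      (solve 2 (λ z e → # 0 :* z :+ e :* # 1 :* # 1 := e :* # 1) refl (s k) (w m)))
    canonical-act (mt i j) 0F = Mt-maps-C c c≢0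
      (trans (lincomb₂ (solve 3 (λ t x y → :- t :* x :* # 1 :+ # 1 :* # 0
                                   := :- (# 2 :* (:- t :* x) :* (t :* y)) :* (t :* t :* (y :* y))
                                      :+ (:- t :* x) :* (# 2 :* (t :* t :* t) :- :- # 1)
                                      :+ (:- (# 2 :* t :* t :* t :* t :* x)) :* (y :* y :* y :- # 1))
                         refl t (w i) (w j)) 2t³≡-1 (w-cube j))
             (cong (λ v → c * (t * t * v)) (w-⊕ j j)))
      (solve 2 (λ c d → c :* # 1 :+ d :* # 0 := c :* # 1) refl c d[ j ])
      where
      c : F
      c = - (2# * a[ i ] * d[ j ])
      c≢0 : c ≢ 0#
      c≢0 = -x≢0 (x*y≢0 (x*y≢0 2≢0 (x*y≢0 (-x≢0 t≢0) (w≢0 i))) (x*y≢0 t≢0 (w≢0 j)))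
    canonical-act (mt i j) (suc k) = mt-moves i j k (i ⊕ k) refl

    canonical-injective : ∀ K K′ → canonical K ∼ canonical K′ → K ≡ K′
    canonical-injective K K′ K∼K′ = act-injective K K′ λ x →
      pt-injective (act K x) (act K′ x)
        (≃-trans (≃-sym (canonical-act K x)) (≃-trans (⋆-congʳ (pt x) K∼K′) (canonical-act K′ x)))

    classify-canonical : ∀ M → InGL M → Σ Kind λ K → M ∼ canonical K
    classify-canonical M M∈GL = [ from-diag , from-mt ]′ (classify M M∈GL)
      where
      from-diag : DiagForm M → Σ Kind λ K → M ∼ canonical K
      from-diag (d , d³≡1 , M∼Diag) = let (m , d≡w) = cube≡1⇒w d d³≡1 in diag m , subst (λ d → M ∼ Diag d) d≡w M∼Diag
      from-mt : MtForm M → Σ Kind λ K → M ∼ canonical K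
      from-mt (a , d , c , 2a³≡1 , 2d³≡-1 , ca²≡-d , M∼Mt) = mt i j , ∼-trans M∼Mt (∼-≗ (Mt-cong a≡ refl c≡ d≡))
        where
        2[-t]³≡1 : 2# * cube (- t) ≡ 1#
        2[-t]³≡1 = lincomb₁ (solve 1 (λ t → # 2 :* (:- t :* :- t :* :- t)
                                           := # 1 :+ (:- # 1) :* (# 2 :* (t :* t :* t) :- :- # 1)) refl t) 2t³≡-1
        a-ratio : Σ (Fin 3) λ k → a * inv (- t) (-x≢0 t≢0) ≡ w k
        a-ratio = cube≡1⇒w _ (cube-ratio a (- t) (-x≢0 t≢0) (*-cancelˡ 2≢0 (trans 2a³≡1 (sym 2[-t]³≡1))))
        d-ratio : Σ (Fin 3) λ k → d * inv t t≢0 ≡ w k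
        d-ratio = cube≡1⇒w _ (cube-ratio d t t≢0 (*-cancelˡ 2≢0 (trans 2d³≡-1 (sym 2t³≡-1))))
        i j : Fin 3
        i = proj₁ a-ratio
        j = proj₁ d-ratio
        a≡ : a ≡ a[ i ]
        a≡ = trans (sym (ratio-* a (- t) (-x≢0 t≢0))) (trans (cong (_* - t) (proj₂ a-ratio)) (*-comm _ _))
        d≡ : d ≡ d[ j ]
        d≡ = trans (sym (ratio-* d t t≢0)) (trans (cong (_* t) (proj₂ d-ratio)) (*-comm _ _))
        c≡ : c ≡ - (2# * a[ i ] * d[ j ])
        c≡ = trans (c≡-2ad 2a³≡1 ca²≡-d) (cong₂ (λ x y → - (2# * x * y)) a≡ d≡)

    kind-of : ∀ M → InGL M → Kind
    kind-of M M∈GL = proj₁ (classify-canonical M M∈GL)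

    kind-of-act : ∀ M M∈GL x → pt x ⋆ M ≃ pt (act (kind-of M M∈GL) x)
    kind-of-act M M∈GL x = ≃-trans (⋆-congʳ (pt x) (proj₂ (classify-canonical M M∈GL))) (canonical-act (kind-of M M∈GL) x)

    kind-of-∼ : ∀ M N M∈GL N∈GL → M ∼ N → kind-of M M∈GL ≡ kind-of N N∈GL
    kind-of-∼ M N M∈GL N∈GL M∼N = canonical-injective (kind-of M M∈GL) (kind-of N N∈GL)
      (∼-trans (∼-sym (proj₂ (classify-canonical M M∈GL))) (∼-trans M∼N (proj₂ (classify-canonical N N∈GL))))

    kind-of-canonical : ∀ K → kind-of (canonical K) (canonical∈GL K) ≡ K
    kind-of-canonical K = canonical-injective (kind-of (canonical K) (canonical∈GL K)) K
      (∼-sym (proj₂ (classify-canonical (canonical K) (canonical∈GL K))))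

    G≅A₄ : IsoA4
    G≅A₄ = φ , (λ M M∈GL → perm-even (kind-of M M∈GL))
         , (λ M N M∈GL N∈GL M∼N x → cong (λ K → act K x) (kind-of-∼ M N M∈GL N∈GL M∼N))
         , φ-injective , φ-surjective , φ-homomorphism
      where
      φ : (M : Mat4) → InGL M → Perm4
      φ M M∈GL = perm (kind-of M M∈GL)
      φ-injective : ∀ M N M∈GL N∈GL → φ M M∈GL Perm.≈ φ N N∈GL → M ∼ N
      φ-injective M N M∈GL N∈GL φM≈φN = ∼-trans (proj₂ (classify-canonical M M∈GL))
        (subst (λ K → canonical K ∼ N) (sym (act-injective (kind-of M M∈GL) (kind-of N N∈GL) φM≈φN))
               (∼-sym (proj₂ (classify-canonical N N∈GL))))
      φ-surjective : ∀ σ → Even σ → Σ Mat4 λ M → Σ (InGL M) λ M∈GL → φ M M∈GL Perm.≈ σ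
      φ-surjective σ σ-even = let (K , K≈σ) = even⇒perm σ σ-even in
        canonical K , canonical∈GL K , λ x → trans (cong (λ K′ → act K′ x) (kind-of-canonical K)) (K≈σ x)
      φ-homomorphism : ∀ M N M∈GL N∈GL MN∈GL → φ (M ·ₘ N) MN∈GL Perm.≈ (φ M M∈GL ∘ₚ φ N N∈GL)
      φ-homomorphism M N M∈GL N∈GL MN∈GL x =
        pt-injective (act (kind-of (M ·ₘ N) MN∈GL) x) (act (kind-of N N∈GL) (act (kind-of M M∈GL) x))
        (≃-trans (≃-sym (kind-of-act (M ·ₘ N) MN∈GL x))
        (≃-trans (≃-pointwise (⋆-·ₘ (pt x) M N))
        (≃-trans (⋆-congˡ N (kind-of-act M M∈GL x)) (kind-of-act N N∈GL (act (kind-of M M∈GL) x)))))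

    order-12 : HasOrder 12
    order-12 = canonical ∘ kind , canonical∈GL ∘ kind
             , (λ i j i∼j → trans (sym (Inverse.strictlyInverseʳ kinds i))
                  (trans (cong (Inverse.from kinds) (canonical-injective (kind i) (kind j) i∼j)) (Inverse.strictlyInverseʳ kinds j)))
             , λ M M∈GL → Inverse.from kinds (kind-of M M∈GL)
                        , subst (λ K → M ∼ canonical K) (sym (Inverse.strictlyInverseˡ kinds (kind-of M M∈GL)))
                                (proj₂ (classify-canonical M M∈GL))

  part-ii : q % 2 ≡ 1 → q % 3 ≡ 1 → (Σ F λ t → 2# * cube t ≡ - 1#) →
      HasOrder 12 × IsoA4 × (∀ M → InGL M → DiagForm M ⊎ MtForm M)
  part-ii q-odd q%3≡1 (t , 2t³≡-1) = order-12 , G≅A₄ , classify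
    where
    2≢0 : 2# ≢ 0#
    2≢0 = odd⇒2≢0 q-odd
    3≢0 : 3# ≢ 0#
    3≢0 = 3∤q⇒3≢0 2≢0 (inj₁ q%3≡1)
    ω-data : Σ F λ ω → cube ω ≡ 1# × ω ≢ 1#
    ω-data = Cubes≡1mod3.primitive-cube-root-of-1 q%3≡1
    open Classification 3≢0 using (classify)
    open Tetrahedral 2≢0 3≢0 t 2t³≡-1 (proj₁ ω-data) (proj₁ (proj₂ ω-data)) (proj₂ (proj₂ ω-data))

lemma3p4 : (q : ℕ) (𝔽 : FiniteField q) → let open Geometry 𝔽 in
    q % 2 ≡ 1 →
      (q % 3 ≡ 2 →
          (∀ x y → cube x ≡ cube y → x ≡ y)
        × (Σ F λ a → Σ F λ c → (2# * cube a ≡ 1#) × (cube c ≡ 2#))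
        × (∀ a c → 2# * cube a ≡ 1# → cube c ≡ 2# →
             Enumerates (pair Id (Mt a 1# c (- a)))))
    × (q % 3 ≡ 1 → (Σ F λ t → 2# * cube t ≡ - 1#) →
          HasOrder 12
        × IsoA4
        × (∀ M → InGL M →
             (Σ F λ d → (cube d ≡ 1#) × (M ∼ Diag d))
           ⊎ (Σ F λ a → Σ F λ d → Σ F λ c →
                (2# * cube a ≡ 1#) × (2# * cube d ≡ - 1#) × (c * (a * a) ≡ - d)
                × (M ∼ Mt a 1# c d))))
lemma3p4 q 𝔽 q-odd = part-i 𝔽 q-odd , part-ii 𝔽 q-odd
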